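{- For every $n\ge0$, the map $F_R$ is a bijection from $\mathrm{PW}_n$ onto the set of red-packed forests of weight $n$, and $T_R$ is a bijection from the set of irreducible packed words of length $n$ onto the set of red-packed trees of weight $n$. Their inverses are the maps $F_R^*$, $T_R^*$ defined recursively by $F_R^*([])=\varepsilon$, $F_R^*([t_1,\dots,t_k])=T_R^*(t_1)\odot\cdots\odot T_R^*(t_k)$, and $T_R^*(\mathrm{Node}(I,f_\ell,f_r))=F_R^*(f_\ell)\triangleleft_R\phi_I(F_R^*(f_r))$.
   Context: Words over positive integers; $|w|$ length, $\max(w)$ largest letter ($\max(\varepsilon)=0$), $w^{[k]}$ adds $k$ to all letters. Packed: every integer $1..\max(w)$ occurs; $\mathrm{PW}_n$ packed words of length $n$. Left-shifted concatenation $u\odot v=u^{[\max(v)]}\cdot v$ (associative). A global descent of $w\in\mathrm{PW}_n$ is $c$, $1\le c\le n-1$, with every letter among $w_1..w_c$ strictly greater than every letter among $w_{c+1}..w_n$; $w$ is irreducible if nonempty without global descent. Every packed $w$ decomposes uniquely as $w=w_1\odot\cdots\odot w_k$ with all $w_j$ irreducible ($k=0$ iff $w=\varepsilon$). For $w\in\mathrm{PW}_n$, $p\ge1$, $I=\{i_1<\dots<i_p\}\subseteq\{1,\dots,n+p\}$: $\phi_I(w)$ is the word of length $n+p$ with letter $\max(w)+1$ at positions in $I$ and the letters of $w$ in order elsewhere; each nonempty packed $v$ is uniquely $\phi_I(v')$. For packed $u$ and nonempty packed $v=\phi_I(v')$, $u\triangleleft_R v=\phi_{I+|u|}(u\odot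 v')$ with $I+|u|=\{i+|u|:i\in I\}$. The red-factorization of an irreducible $w$ is the (unique) pair $(u,v)$ of packed words, $v\ne\varepsilon$, with $w=u\triangleleft_R v$ and $|u|$ maximal. Biplane trees: $\mathrm{Node}(x,f_\ell,f_r)$ with root label $x$ and ordered possibly empty lists $f_\ell$ (left forest), $f_r$ (right forest) of trees; forests are ordered lists of trees. Red-packed trees are labeled by nonempty finite sets $I=\{i_1<\dots<i_p\}$ of positive integers; weight $\omega=|I|$ + weights of all children trees (forest weight = sum). $\mathrm{Node}(I,[\ell_1..\ell_g],[r_1..r_d])$ is red-packed if all children are red-packed and either ($d=0$, $I=\{1..p\}$) or ($d\ge1$, $1\le i_1\le\omega(r_1)$, $1\le p+\sum_j\omega(r_j)+1-i_p\le\omega(r_d)$); a red-packed forest is a list of red-packed trees. $F_R$, $T_R$ are defined by mutual recursion: $F_R(\varepsilon)=[]$; for packed $w=w_1\odot\cdots\odot w_k$ (irreducible decomposition), $F_R(w)=[T_R(w_1),\dots,T_R(w_k)]$; for irreducible $w$ with red-factorization $(u,\phi_I(v'))$, $T_R(w)=\mathrm{Node}(I,F_R(u),F_R(v'))$. -}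

module Defs where

open import Data.Nat using (ℕ; zero; suc; _+_; _∸_; _≤_; _<_; _⊔_; _≡ᵇ_)
open import Data.Bool using (true; false)
open import Data.List using (List; []; _∷_; _++_; map; foldr; length; take; drop; applyUpTo)
open import Data.List.Membership.Propositional using (_∈_)
open import Data.List.Relation.Unary.All using (All)
open import Data.List.Relation.Unary.AllPairs using (AllPairs)
open import Data.Product using (Σ; _×_; ∃)
open import Data.Empty using (⊥)
open import Data.Unit using (⊤)
open import Relation.Nullary using (¬_)
open import Relation.Binary.PropositionalEquality using (_≡_; _≢_)

Word : Set
Word = List ℕ

maxW : Word → ℕ
maxW = foldr _⊔_ 0

shift : ℕ → Word → Word
shift k = map (k +_)

Packed : Word → Set
Packed w = (∀ x → x ∈ w → 1 ≤ x) × (∀ i → 1 ≤ i → i ≤ maxW w → i ∈ w)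

infixr 6 _⊙_
_⊙_ : Word → Word → Word
u ⊙ v = shift (maxW v) u ++ v

GlobalDescent : Word → ℕ → Set
GlobalDescent w c =
  1 ≤ c × suc c ≤ length w ×
  (∀ x y → x ∈ take c w → y ∈ drop c w → y < x)

Irreducible : Word → Set
Irreducible w = w ≢ [] × ¬ (∃ λ c → GlobalDescent w c)

-- φ_I(w): insert letter a at the positions of I (lists of positions,
-- read as strictly increasing), the letters of w in order elsewhere.

ins : ℕ → ℕ → List ℕ → Word → Word
ins a pos [] w = w
ins a pos (i ∷ I) w with i ≡ᵇ pos
... | true = a ∷ ins a (suc pos) I w
ins a pos (i ∷ I) [] | false = []
ins a pos (i ∷ I) (x ∷ w) | false = x ∷ ins a (suc pos) (i ∷ I) w

φ : List ℕ → Word → Word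
φ I w = ins (suc (maxW w)) 1 I w

-- finite nonempty set of positive integers, represented as a
-- strictly increasing nonempty list
IsSet : List ℕ → Set
IsSet I = I ≢ [] × All (1 ≤_) I × AllPairs _<_ I

-- I ⊆ {1..n+p} with p = |I| ≥ 1  (the admissible index sets for φ_I on words of length n)
ValidI : List ℕ → ℕ → Set
ValidI I n = IsSet I × All (_≤ n + length I) I

-- u ◁_R φ_I(v') = φ_{I+|u|}(u ⊙ v')
redProd : Word → List ℕ → Word → Word
redProd u I v' = φ (map (length u +_) I) (u ⊙ v')

RedFact : Word → Word → List ℕ → Word → Set
RedFact w u I v' =
  Packed u × Packed v' × ValidI I (length v') × w ≡ redProd u I v' ×
  (∀ u₂ I₂ v₂ → Packed u₂ → Packed v₂ → ValidI I₂ (length v₂) →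
     w ≡ redProd u₂ I₂ v₂ → length u₂ ≤ length u)

IrrDecomp : Word → List Word → Set
IrrDecomp w ws = w ≡ foldr _⊙_ [] ws × All (λ x → Packed x × Irreducible x) ws

-- Biplane trees labelled by lists of naturals (index sets)

data Tree : Set where
  Node : List ℕ → List Tree → List Tree → Tree

Forest : Set
Forest = List Tree

mutual
  ω : Tree → ℕ
  ω (Node I fl fr) = length I + ωF fl + ωF fr

  ωF : Forest → ℕ
  ωF [] = 0
  ωF (t ∷ ts) = ω t + ωF ts

lastOr : {A : Set} → A → List A → A
lastOr a [] = a
lastOr a (b ∷ bs) = lastOr b bs

RedCond : List ℕ → Forest → Set
RedCond I [] = I ≡ applyUpTo suc (length I)
RedCond [] (r ∷ rs) = ⊥
RedCond (i ∷ I') (r ∷ rs) =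
  (1 ≤ i × i ≤ ω r) ×
  (1 ≤ suc (length (i ∷ I') + ωF (r ∷ rs)) ∸ lastOr i I' ×
   suc (length (i ∷ I') + ωF (r ∷ rs)) ∸ lastOr i I' ≤ ω (lastOr r rs))

mutual
  RedPackedT : Tree → Set
  RedPackedT (Node I fl fr) = IsSet I × RedPackedF fl × RedPackedF fr × RedCond I fr

  RedPackedF : Forest → Set
  RedPackedF [] = ⊤
  RedPackedF (t ∷ ts) = RedPackedT t × RedPackedF ts

-- F_R and T_R, as the graphs of the paper's mutually recursive definitions
--   F_R(w) = [T_R(w₁),…,T_R(w_k)] for w = w₁ ⊙ ⋯ ⊙ w_k (irreducible decomposition)
--   T_R(w) = Node(I, F_R(u), F_R(v')) for red-factorization (u, φ_I(v')) of w

mutual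
  data FR : Word → Forest → Set where
    mkFR : ∀ {w ws ts} → IrrDecomp w ws → TRs ws ts → FR w ts

  data TRs : List Word → Forest → Set where
    []  : TRs [] []
    _∷_ : ∀ {w ws t ts} → TR w t → TRs ws ts → TRs (w ∷ ws) (t ∷ ts)

  data TR : Word → Tree → Set where
    mkTR : ∀ {w u I v' fl fr} → RedFact w u I v' → FR u fl → FR v' fr →
         TR w (Node I fl fr)

mutual
  TS : Tree → Word
  TS (Node I fl fr) = redProd (FS fl) I (FS fr)

  FS : Forest → Word
  FS [] = []
  FS (t ∷ ts) = TS t ⊙ FS ts

-- R (a relation, i.e. the graph of a map) is a bijection from the
-- elements satisfying Dom onto those satisfying Cod, with inverse g.

IsBijWithInverse : {A B : Set} → (A → Set) → (B → Set) → (A → B → Set) → (B → A) → Set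
IsBijWithInverse {A} {B} Dom Cod R g =
  (∀ a → Dom a → Σ B (R a)) ×
  (∀ a b b′ → Dom a → R a b → R a b′ → b ≡ b′) ×
  (∀ a b → Dom a → R a b → Cod b) ×
  (∀ a b → Dom a → R a b → g b ≡ a) ×
  (∀ b → Cod b → Dom (g b) × R (g b) b)

{-# OPTIONS --safe #-}
-- Functionality of F_R and T_R is the uniqueness of the two factorizations involved. For the
-- irreducible decomposition, a longer first factor than an irreducible a would contain a global
-- descent. For the red factorization, u ◁_R φ_I(v′) determines I + |u| and u ⊙ v′, hence
-- everything once |u| is fixed, and |u| is fixed by maximality. Maximality of |u| holds exactly
-- when i₁ lies within the first irreducible factor of v′: otherwise that factor can be moved into
-- u, and a longer u would put a global descent into that factor. Red factorizations therefore
-- exist: start from w = ε ◁_R φ_J(w without its largest letter) and absorb factors greedily.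
-- The conditions on red-packed labels translate the bounds on I, maximality (i₁ ≤ ω(r₁)), and
-- irreducibility of w: the last position of I must reach into the last irreducible factor L
-- of v′, for otherwise everything before L dominates L.
module Submission where

open import Defs
open import Data.Nat using (ℕ; zero; suc; _+_; _∸_; _≤_; _<_; _⊔_; _≡ᵇ_; z≤n; s≤s; _≟_; _≤?_; _<?_)
open import Data.Nat.Properties
open import Data.Nat.Induction using (<-wellFounded)
open import Induction.WellFounded using (Acc; acc)
open import Data.Bool using (true; false)
open import Data.List using (List; []; _∷_; _++_; map; foldr; length; take; drop; applyUpTo)
open import Data.List.Properties
  using (map-++; length-map; length-++; map-id; ++-assoc; ++-identityʳ; ∷-injective; ∷-injectiveˡ;
         ∷-injectiveʳ; take++drop≡id; take-map; drop-map; length-drop; drop-drop; take-[]; drop-[]; map-injective)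
open import Data.List.Membership.Propositional using (_∈_; lose)
open import Data.List.Membership.Propositional.Properties using (∈-++⁺ˡ; ∈-++⁺ʳ; ∈-++⁻; ∈-map⁻; ∈-map⁺)
open import Data.List.Relation.Binary.Subset.Propositional using (_⊆_)
open import Data.List.Relation.Unary.Any as Any using (Any; here; there)
open import Data.List.Relation.Unary.All as All using (All; []; _∷_)
import Data.List.Relation.Unary.All.Properties as AllP
open import Data.List.Relation.Unary.AllPairs as AllPairs using (AllPairs; []; _∷_)
import Data.List.Relation.Unary.AllPairs.Properties as AllPairsP
open import Data.Product using (∃; _×_; _,_; proj₁; proj₂; map₁)
open import Data.Sum using (_⊎_; inj₁; inj₂; [_,_]′)
open import Data.Empty using (⊥; ⊥-elim)
open import Data.Unit using (tt)
open import Relation.Nullary using (¬_; Dec; yes; no; contradiction; map′; _×-dec_)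
open import Relation.Binary.PropositionalEquality
  using (_≡_; _≢_; refl; sym; trans; cong; cong₂; subst; subst₂; module ≡-Reasoning)
open import Relation.Binary.Definitions using (tri<; tri≈; tri>)
open import Function using (_∘_)

m<o∸n⇒n+m<o : ∀ m o n → m < o ∸ n → n + m < o
m<o∸n⇒n+m<o m o       zero    lt = lt
m<o∸n⇒n+m<o m (suc o) (suc n) lt = s≤s (m<o∸n⇒n+m<o m o n lt)

m∸n≤o⇒m≤n+o : ∀ o m n → m ∸ n ≤ o → m ≤ n + o
m∸n≤o⇒m≤n+o o m       zero    le = le
m∸n≤o⇒m≤n+o o zero    (suc n) le = z≤n
m∸n≤o⇒m≤n+o o (suc m) (suc n) le = s≤s (m∸n≤o⇒m≤n+o o m n le)

≢[]⇒1≤length : ∀ {A : Set} (xs : List A) → xs ≢ [] → 1 ≤ length xs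
≢[]⇒1≤length []      xs≢[] = contradiction refl xs≢[]
≢[]⇒1≤length (_ ∷ _) _     = s≤s z≤n

module _ {A : Set} where

  take-length-++ : ∀ (xs ys : List A) → take (length xs) (xs ++ ys) ≡ xs
  take-length-++ []       ys = refl
  take-length-++ (x ∷ xs) ys = cong (x ∷_) (take-length-++ xs ys)

  drop-length-++ : ∀ (xs ys : List A) → drop (length xs) (xs ++ ys) ≡ ys
  drop-length-++ []       ys = refl
  drop-length-++ (x ∷ xs) ys = drop-length-++ xs ys

  take-++-≤ : ∀ k (xs ys : List A) → k ≤ length xs → take k (xs ++ ys) ≡ take k xs
  take-++-≤ zero    xs       ys _         = refl
  take-++-≤ (suc k) (x ∷ xs) ys (s≤s k≤) = cong (x ∷_) (take-++-≤ k xs ys k≤)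

  drop-++-≤ : ∀ k (xs ys : List A) → k ≤ length xs → drop k (xs ++ ys) ≡ drop k xs ++ ys
  drop-++-≤ zero    xs       ys _         = refl
  drop-++-≤ (suc k) (x ∷ xs) ys (s≤s k≤) = drop-++-≤ k xs ys k≤

  take-++-+ : ∀ n (xs ys : List A) → take (length xs + n) (xs ++ ys) ≡ xs ++ take n ys
  take-++-+ n []       ys = refl
  take-++-+ n (x ∷ xs) ys = cong (x ∷_) (take-++-+ n xs ys)

  drop-++-+ : ∀ n (xs ys : List A) → drop (length xs + n) (xs ++ ys) ≡ drop n ys
  drop-++-+ n []       ys = refl
  drop-++-+ n (x ∷ xs) ys = drop-++-+ n xs ys

  take-+ : ∀ m n (xs : List A) → take (m + n) xs ≡ take m xs ++ take n (drop m xs)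
  take-+ zero    n xs       = refl
  take-+ (suc m) n []       = sym (take-[] n)
  take-+ (suc m) n (x ∷ xs) = cong (x ∷_) (take-+ m n xs)

  ∈-take : ∀ {y} k (xs : List A) → y ∈ take k xs → y ∈ xs
  ∈-take (suc k) (x ∷ xs) (here y≡x) = here y≡x
  ∈-take (suc k) (x ∷ xs) (there y∈) = there (∈-take k xs y∈)

  ∈-drop : ∀ {y} k (xs : List A) → y ∈ drop k xs → y ∈ xs
  ∈-drop zero    xs       y∈ = y∈
  ∈-drop (suc k) (x ∷ xs) y∈ = there (∈-drop k xs y∈)

  ∈-drop⇒< : ∀ {y} k (xs : List A) → y ∈ drop k xs → k < length xs
  ∈-drop⇒< zero    (x ∷ xs) _  = s≤s z≤n
  ∈-drop⇒< (suc k) (x ∷ xs) y∈ = s≤s (∈-drop⇒< k xs y∈)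

  drop-nonempty : ∀ k (xs : List A) → k < length xs → ∃ λ y → y ∈ drop k xs
  drop-nonempty zero    (x ∷ xs) _        = x , here refl
  drop-nonempty (suc k) (x ∷ xs) (s≤s k<) = drop-nonempty k xs k<

  length-take-≤ : ∀ k (xs : List A) → k ≤ length xs → length (take k xs) ≡ k
  length-take-≤ zero    xs       _        = refl
  length-take-≤ (suc k) (x ∷ xs) (s≤s k≤) = cong suc (length-take-≤ k xs k≤)

  ++-cancel-length : ∀ (xs ys xs′ ys′ : List A) → xs ++ ys ≡ xs′ ++ ys′ → length xs ≡ length xs′ →
                     xs ≡ xs′ × ys ≡ ys′
  ++-cancel-length xs ys xs′ ys′ eq |xs|≡|xs′| =
    trans (sym (take-length-++ xs ys)) (trans (cong₂ take |xs|≡|xs′| eq) (take-length-++ xs′ ys′)) ,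
    trans (sym (drop-length-++ xs ys)) (trans (cong₂ drop |xs|≡|xs′| eq) (drop-length-++ xs′ ys′))

  lastOr∈ : ∀ (x : A) xs → lastOr x xs ∈ (x ∷ xs)
  lastOr∈ x []       = here refl
  lastOr∈ x (y ∷ xs) = there (lastOr∈ y xs)

  All-lastOr : ∀ {P : A → Set} {x xs} → All P (x ∷ xs) → P (lastOr x xs)
  All-lastOr (px ∷ [])        = px
  All-lastOr (px ∷ (py ∷ ps)) = All-lastOr (py ∷ ps)

lastOr-map : ∀ {A B : Set} (f : A → B) x xs → lastOr (f x) (map f xs) ≡ f (lastOr x xs)
lastOr-map f x []       = refl
lastOr-map f x (y ∷ xs) = lastOr-map f y xs

increasing-≤lastOr : ∀ i I → AllPairs _<_ (i ∷ I) → All (_≤ lastOr i I) (i ∷ I)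
increasing-≤lastOr i []      _ = ≤-refl ∷ []
increasing-≤lastOr i (j ∷ I) ((i<j ∷ _) ∷ incr) with increasing-≤lastOr j I incr
... | j≤ ∷ rest = <⇒≤ (<-≤-trans i<j j≤) ∷ j≤ ∷ rest

-- Inserting a letter at given positions

-- The position sets J that `ins _ pos J` fully uses on a word of length n.
Admissible : ℕ → List ℕ → ℕ → Set
Admissible pos J n = AllPairs _<_ J × All (pos ≤_) J × All (_< pos + n + length J) J

increasing-within⇒length≤ : ∀ lo hi i J → AllPairs _<_ (i ∷ J) → All (lo ≤_) (i ∷ J) → All (_< hi) (i ∷ J) →
                            lo + length (i ∷ J) ≤ hi
increasing-within⇒length≤ lo hi i []      _ (lo≤i ∷ []) (i<hi ∷ []) =
  ≤-trans (≤-reflexive (+-comm lo 1)) (≤-trans (s≤s lo≤i) i<hi)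
increasing-within⇒length≤ lo hi i (j ∷ J) ((i<j ∷ i<J) ∷ incr) (lo≤i ∷ _) (_ ∷ <hi) = begin
  lo + suc (length (j ∷ J))   ≡⟨ +-suc lo _ ⟩
  suc lo + length (j ∷ J)     ≤⟨ +-monoˡ-≤ _ (s≤s lo≤i) ⟩
  suc i + length (j ∷ J)      ≤⟨ increasing-within⇒length≤ (suc i) hi j J incr (i<j ∷ i<J) <hi ⟩
  hi                          ∎
  where open ≤-Reasoning

admissible-[]-head : ∀ {pos i J} → Admissible pos (i ∷ J) 0 → i ≡ pos
admissible-[]-head {pos} {i} {J} (incr , pos≤i ∷ _ , <end) with i ≟ pos
... | yes i≡pos = i≡pos
... | no  i≢pos = contradiction (≤-trans too-long (≤-reflexive (cong (_+ length (i ∷ J)) (+-identityʳ pos))))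
                                (<-irrefl refl)
  where
  pos<i : pos < i
  pos<i = ≤∧≢⇒< pos≤i (i≢pos ∘ sym)
  too-long : suc pos + length (i ∷ J) ≤ pos + 0 + length (i ∷ J)
  too-long = increasing-within⇒length≤ (suc pos) _ i J incr
               (pos<i ∷ All.map (<-trans pos<i) (AllPairs.head incr)) <end

admissible-here : ∀ {pos J n} → Admissible pos (pos ∷ J) n → Admissible (suc pos) J n
admissible-here {pos} {J} {n} ((pos<J ∷ incr) , _ ∷ _ , _ ∷ <end) =
  incr , pos<J , All.map (λ j< → ≤-trans j< (≤-reflexive (+-suc (pos + n) (length J)))) <end

admissible-skip : ∀ {pos i J n} → i ≢ pos → Admissible pos (i ∷ J) (suc n) → Admissible (suc pos) (i ∷ J) n
admissible-skip {pos} {i} {J} {n} i≢pos (incr , pos≤i ∷ _ , <end) =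
  incr , pos<i ∷ All.map (<-trans pos<i) (AllPairs.head incr) ,
  All.map (λ j< → ≤-trans j< (≤-reflexive (cong (_+ length (i ∷ J)) (+-suc pos n)))) <end
  where
  pos<i : pos < i
  pos<i = ≤∧≢⇒< pos≤i (i≢pos ∘ sym)

ins-here : ∀ a pos J x → ins a pos (pos ∷ J) x ≡ a ∷ ins a (suc pos) J x
ins-here a pos J x with pos ≡ᵇ pos | ≡⇒≡ᵇ pos pos refl
... | true  | _ = refl
... | false | ()

ins-skip : ∀ a pos i J y x → i ≢ pos → ins a pos (i ∷ J) (y ∷ x) ≡ y ∷ ins a (suc pos) (i ∷ J) x
ins-skip a pos i J y x i≢pos with i ≡ᵇ pos | ≡ᵇ⇒≡ i pos
... | true  | i≡pos = contradiction (i≡pos tt) i≢pos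
... | false | _     = refl

ins-skip-[] : ∀ a pos i J → i ≢ pos → ins a pos (i ∷ J) [] ≡ []
ins-skip-[] a pos i J i≢pos with i ≡ᵇ pos | ≡ᵇ⇒≡ i pos
... | true  | i≡pos = contradiction (i≡pos tt) i≢pos
... | false | _     = refl

length-ins : ∀ a pos J x → Admissible pos J (length x) → length (ins a pos J x) ≡ length x + length J
length-ins a pos []      x adm = sym (+-identityʳ _)
length-ins a pos (i ∷ J) x adm with i ≟ pos
length-ins a pos (i ∷ J) x       adm | yes refl =
  trans (cong length (ins-here a pos J x))
        (trans (cong suc (length-ins a (suc pos) J x (admissible-here adm))) (sym (+-suc _ _)))
length-ins a pos (i ∷ J) []      adm | no i≢pos = contradiction (admissible-[]-head adm) i≢pos
length-ins a pos (i ∷ J) (y ∷ x) adm | no i≢pos =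
  trans (cong length (ins-skip a pos i J y x i≢pos))
        (cong suc (length-ins a (suc pos) (i ∷ J) x (admissible-skip i≢pos adm)))

∈-ins⁻ : ∀ a pos J x {y} → y ∈ ins a pos J x → y ∈ x ⊎ y ≡ a
∈-ins⁻ a pos []      x y∈ = inj₁ y∈
∈-ins⁻ a pos (i ∷ J) x y∈ with i ≟ pos
∈-ins⁻ a pos (i ∷ J) x       y∈ | yes refl with subst (_ ∈_) (ins-here a pos J x) y∈
... | here y≡a  = inj₂ y≡a
... | there y∈′ = ∈-ins⁻ a (suc pos) J x y∈′
∈-ins⁻ a pos (i ∷ J) []      y∈ | no i≢pos with subst (_ ∈_) (ins-skip-[] a pos i J i≢pos) y∈
... | ()
∈-ins⁻ a pos (i ∷ J) (z ∷ x) y∈ | no i≢pos with subst (_ ∈_) (ins-skip a pos i J z x i≢pos) y∈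
... | here y≡z  = inj₁ (here y≡z)
... | there y∈′ = [ inj₁ ∘ there , inj₂ ]′ (∈-ins⁻ a (suc pos) (i ∷ J) x y∈′)

∈-ins⁺ : ∀ a pos J x {y} → y ∈ x → y ∈ ins a pos J x
∈-ins⁺ a pos []      x       y∈ = y∈
∈-ins⁺ a pos (i ∷ J) x       y∈ with i ≟ pos
∈-ins⁺ a pos (i ∷ J) x       y∈         | yes refl =
  subst (_ ∈_) (sym (ins-here a pos J x)) (there (∈-ins⁺ a (suc pos) J x y∈))
∈-ins⁺ a pos (i ∷ J) (z ∷ x) (here y≡z) | no i≢pos =
  subst (_ ∈_) (sym (ins-skip a pos i J z x i≢pos)) (here y≡z)
∈-ins⁺ a pos (i ∷ J) (z ∷ x) (there y∈) | no i≢pos =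
  subst (_ ∈_) (sym (ins-skip a pos i J z x i≢pos)) (there (∈-ins⁺ a (suc pos) (i ∷ J) x y∈))

letter∈ins : ∀ a pos j J x → Admissible pos (j ∷ J) (length x) → a ∈ ins a pos (j ∷ J) x
letter∈ins a pos j J x       adm with j ≟ pos
letter∈ins a pos j J x       adm | yes refl = subst (a ∈_) (sym (ins-here a pos J x)) (here refl)
letter∈ins a pos j J []      adm | no j≢pos = contradiction (admissible-[]-head adm) j≢pos
letter∈ins a pos j J (y ∷ x) adm | no j≢pos =
  subst (a ∈_) (sym (ins-skip a pos j J y x j≢pos))
        (there (letter∈ins a (suc pos) j J x (admissible-skip j≢pos adm)))

ins-injective : ∀ a pos J J′ x x′ → Admissible pos J (length x) → Admissible pos J′ (length x′) →
                ¬ a ∈ x → ¬ a ∈ x′ → ins a pos J x ≡ ins a pos J′ x′ → J ≡ J′ × x ≡ x′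
ins-injective a pos []      []        x x′ _   _    _   _    eq = refl , eq
ins-injective a pos []      (j′ ∷ J′) x x′ _   adm′ a∉x _    eq =
  contradiction (subst (a ∈_) (sym eq) (letter∈ins a pos j′ J′ x′ adm′)) a∉x
ins-injective a pos (j ∷ J) []        x x′ adm _    _   a∉x′ eq =
  contradiction (subst (a ∈_) eq (letter∈ins a pos j J x adm)) a∉x′
ins-injective a pos (i ∷ J) (i′ ∷ J′) x x′ adm adm′ a∉x a∉x′ eq with i ≟ pos | i′ ≟ pos
... | yes refl | yes refl =
  let J≡J′ , x≡x′ = ins-injective a (suc pos) J J′ x x′ (admissible-here adm) (admissible-here adm′) a∉x a∉x′
                      (∷-injectiveʳ (trans (sym (ins-here a pos J x)) (trans eq (ins-here a pos J′ x′))))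
  in cong (pos ∷_) J≡J′ , x≡x′
ins-injective a pos (i ∷ J) (i′ ∷ J′) x [] adm adm′ a∉x a∉x′ eq | yes refl | no i′≢pos =
  contradiction (admissible-[]-head adm′) i′≢pos
ins-injective a pos (i ∷ J) (i′ ∷ J′) x (y′ ∷ x′) adm adm′ a∉x a∉x′ eq | yes refl | no i′≢pos =
  ⊥-elim (a∉x′ (here (∷-injectiveˡ (trans (sym (ins-here a pos J x)) (trans eq (ins-skip a pos i′ J′ y′ x′ i′≢pos))))))
ins-injective a pos (i ∷ J) (i′ ∷ J′) [] x′ adm adm′ a∉x a∉x′ eq | no i≢pos | yes refl =
  contradiction (admissible-[]-head adm) i≢pos
ins-injective a pos (i ∷ J) (i′ ∷ J′) (y ∷ x) x′ adm adm′ a∉x a∉x′ eq | no i≢pos | yes refl =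
  ⊥-elim (a∉x (here (sym (∷-injectiveˡ (trans (sym (ins-skip a pos i J y x i≢pos)) (trans eq (ins-here a pos J′ x′)))))))
ins-injective a pos (i ∷ J) (i′ ∷ J′) [] x′ adm adm′ a∉x a∉x′ eq | no i≢pos | no _ =
  contradiction (admissible-[]-head adm) i≢pos
ins-injective a pos (i ∷ J) (i′ ∷ J′) (y ∷ x) [] adm adm′ a∉x a∉x′ eq | no _ | no i′≢pos =
  contradiction (admissible-[]-head adm′) i′≢pos
ins-injective a pos (i ∷ J) (i′ ∷ J′) (y ∷ x) (y′ ∷ x′) adm adm′ a∉x a∉x′ eq | no i≢pos | no i′≢pos
  with ∷-injective (trans (sym (ins-skip a pos i J y x i≢pos)) (trans eq (ins-skip a pos i′ J′ y′ x′ i′≢pos)))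
... | refl , tail-eq =
  let J≡J′ , x≡x′ = ins-injective a (suc pos) (i ∷ J) (i′ ∷ J′) x x′
                      (admissible-skip i≢pos adm) (admissible-skip i′≢pos adm′) (a∉x ∘ there) (a∉x′ ∘ there) tail-eq
  in J≡J′ , cong (y ∷_) x≡x′

ins-++-suffix : ∀ a pos J x z → Admissible pos J (length x) → ins a pos J (x ++ z) ≡ ins a pos J x ++ z
ins-++-suffix a pos []      x       z adm = refl
ins-++-suffix a pos (i ∷ J) x       z adm with i ≟ pos
ins-++-suffix a pos (i ∷ J) x       z adm | yes refl =
  trans (ins-here a pos J (x ++ z))
        (trans (cong (a ∷_) (ins-++-suffix a (suc pos) J x z (admissible-here adm)))
               (cong (_++ z) (sym (ins-here a pos J x))))
ins-++-suffix a pos (i ∷ J) []      z adm | no i≢pos = contradiction (admissible-[]-head adm) i≢pos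
ins-++-suffix a pos (i ∷ J) (y ∷ x) z adm | no i≢pos =
  trans (ins-skip a pos i J y (x ++ z) i≢pos)
        (trans (cong (y ∷_) (ins-++-suffix a (suc pos) (i ∷ J) x z (admissible-skip i≢pos adm)))
               (cong (_++ z) (sym (ins-skip a pos i J y x i≢pos))))

ins-++-prefix : ∀ a pos J s x → All (length s + pos ≤_) J → ins a pos J (s ++ x) ≡ s ++ ins a (length s + pos) J x
ins-++-prefix a pos J       []      x _ = refl
ins-++-prefix a pos []      (y ∷ s) x _ = refl
ins-++-prefix a pos (i ∷ J) (y ∷ s) x (s+pos<i ∷ ≤J) =
  trans (ins-skip a pos i J y (s ++ x) i≢pos)
        (trans (cong (y ∷_) (ins-++-prefix a (suc pos) (i ∷ J) s x
                              (All.map (≤-trans (≤-reflexive (+-suc (length s) pos))) (s+pos<i ∷ ≤J))))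
               (cong (λ p → y ∷ s ++ ins a p (i ∷ J) x) (+-suc (length s) pos)))
  where
  i≢pos : i ≢ pos
  i≢pos i≡pos = <-irrefl (sym i≡pos) (≤-trans (s≤s (m≤n+m pos (length s))) s+pos<i)

ins-shift-positions : ∀ a k pos J x → ins a (k + pos) (map (k +_) J) x ≡ ins a pos J x
ins-shift-positions a k pos []      x = refl
ins-shift-positions a k pos (i ∷ J) x with i ≟ pos
ins-shift-positions a k pos (i ∷ J) x       | yes refl =
  trans (ins-here a (k + pos) (map (k +_) J) x)
        (trans (cong (λ p → a ∷ ins a p (map (k +_) J) x) (sym (+-suc k pos)))
               (trans (cong (a ∷_) (ins-shift-positions a k (suc pos) J x)) (sym (ins-here a pos J x))))
ins-shift-positions a k pos (i ∷ J) []      | no i≢pos =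
  trans (ins-skip-[] a (k + pos) (k + i) (map (k +_) J) (i≢pos ∘ +-cancelˡ-≡ k _ _))
        (sym (ins-skip-[] a pos i J i≢pos))
ins-shift-positions a k pos (i ∷ J) (y ∷ x) | no i≢pos =
  trans (ins-skip a (k + pos) (k + i) (map (k +_) J) y x (i≢pos ∘ +-cancelˡ-≡ k _ _))
        (trans (cong (λ p → y ∷ ins a p (map (k +_) (i ∷ J)) x) (sym (+-suc k pos)))
               (trans (cong (y ∷_) (ins-shift-positions a k (suc pos) (i ∷ J) x))
                      (sym (ins-skip a pos i J y x i≢pos))))

admissible-[]⇒consecutive : ∀ pos J → Admissible pos J 0 → J ≡ applyUpTo (pos +_) (length J)
admissible-[]⇒consecutive pos []      adm = refl
admissible-[]⇒consecutive pos (i ∷ J) adm with admissible-[]-head adm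
... | refl = cong₂ _∷_ (sym (+-identityʳ pos))
                   (trans (admissible-[]⇒consecutive (suc pos) J (admissible-here adm))
                          (applyUpTo-cong (length J) (sym ∘ +-suc pos)))
  where
  applyUpTo-cong : ∀ {f g : ℕ → ℕ} n → (∀ k → f k ≡ g k) → applyUpTo f n ≡ applyUpTo g n
  applyUpTo-cong zero    f≗g = refl
  applyUpTo-cong (suc n) f≗g = cong₂ _∷_ (f≗g 0) (applyUpTo-cong n (f≗g ∘ suc))

ins-split-last : ∀ a pos j J x → Admissible pos (j ∷ J) (length x) →
                 ∃ λ Z → ∃ λ k → ins a pos (j ∷ J) x ≡ Z ++ a ∷ drop k x × take k x ⊆ Z
ins-split-last a pos j J       x       adm with j ≟ pos
ins-split-last a pos j []      x       adm | yes refl = [] , 0 , ins-here a pos [] x , λ ()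
ins-split-last a pos j (j′ ∷ J) x      adm | yes refl
  with ins-split-last a (suc pos) j′ J x (admissible-here adm)
... | Z , k , eq , ⊆Z = a ∷ Z , k , trans (ins-here a pos (j′ ∷ J) x) (cong (a ∷_) eq) , there ∘ ⊆Z
ins-split-last a pos j J       []      adm | no j≢pos = contradiction (admissible-[]-head adm) j≢pos
ins-split-last a pos j J       (y ∷ x) adm | no j≢pos
  with ins-split-last a (suc pos) j J x (admissible-skip j≢pos adm)
... | Z , k , eq , ⊆Z = y ∷ Z , suc k , trans (ins-skip a pos j J y x j≢pos) (cong (y ∷_) eq) ,
                        λ { (here z≡y) → here z≡y ; (there z∈) → there (⊆Z z∈) }

ins-split-last-beyond : ∀ a pos J x m → Admissible pos J (length x) → Any (pos + length J + m ≤_) J →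
                        ∃ λ Z → ∃ λ k → m < k × ins a pos J x ≡ Z ++ a ∷ drop k x × take k x ⊆ Z
ins-split-last-beyond a pos (i ∷ J) x m adm far with i ≟ pos
ins-split-last-beyond a pos (i ∷ J) x m adm (here late) | yes refl =
  contradiction (≤-trans (≤-trans (≤-reflexive (+-comm 1 pos)) (≤-trans (+-monoʳ-≤ pos (s≤s z≤n)) (m≤m+n _ m))) late)
                (<-irrefl refl)
ins-split-last-beyond a pos (i ∷ J) x m adm (there far) | yes refl
  with ins-split-last-beyond a (suc pos) J x m (admissible-here adm)
         (Any.map (≤-trans (≤-reflexive (sym (cong (_+ m) (+-suc pos (length J)))))) far)
... | Z , k , m<k , eq , ⊆Z = a ∷ Z , k , m<k , trans (ins-here a pos J x) (cong (a ∷_) eq) , there ∘ ⊆Z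
ins-split-last-beyond a pos (i ∷ J) []      m       adm far | no i≢pos = contradiction (admissible-[]-head adm) i≢pos
ins-split-last-beyond a pos (i ∷ J) (y ∷ x) zero    adm far | no i≢pos
  with ins-split-last a (suc pos) i J x (admissible-skip i≢pos adm)
... | Z , k , eq , ⊆Z = y ∷ Z , suc k , s≤s z≤n , trans (ins-skip a pos i J y x i≢pos) (cong (y ∷_) eq) ,
                        λ { (here z≡y) → here z≡y ; (there z∈) → there (⊆Z z∈) }
ins-split-last-beyond a pos (i ∷ J) (y ∷ x) (suc m) adm far | no i≢pos
  with ins-split-last-beyond a (suc pos) (i ∷ J) x m (admissible-skip i≢pos adm)
         (Any.map (≤-trans (≤-reflexive (sym (+-suc (pos + length (i ∷ J)) m)))) far)
... | Z , k , m<k , eq , ⊆Z = y ∷ Z , suc k , s≤s m<k , trans (ins-skip a pos i J y x i≢pos) (cong (y ∷_) eq) ,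
                              λ { (here z≡y) → here z≡y ; (there z∈) → there (⊆Z z∈) }

-- Maxima, shifts and left-shifted concatenation

∈⇒≤maxW : ∀ {y} w → y ∈ w → y ≤ maxW w
∈⇒≤maxW (a ∷ w) (here refl) = m≤m⊔n a (maxW w)
∈⇒≤maxW (a ∷ w) (there y∈)  = ≤-trans (∈⇒≤maxW w y∈) (m≤n⊔m a (maxW w))

maxW≤ : ∀ w {b} → (∀ {y} → y ∈ w → y ≤ b) → maxW w ≤ b
maxW≤ []      ≤b = z≤n
maxW≤ (a ∷ w) ≤b = ⊔-lub (≤b (here refl)) (maxW≤ w (≤b ∘ there))

maxW∈ : ∀ y w → maxW (y ∷ w) ∈ (y ∷ w)
maxW∈ y []      = here (⊔-identityʳ y)
maxW∈ y (z ∷ w) with ⊔-sel y (maxW (z ∷ w))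
... | inj₁ max≡y = here max≡y
... | inj₂ max≡  = there (subst (_∈ (z ∷ w)) (sym max≡) (maxW∈ z w))

maxW-++ : ∀ x y → maxW (x ++ y) ≡ maxW x ⊔ maxW y
maxW-++ []      y = refl
maxW-++ (a ∷ x) y = trans (cong (a ⊔_) (maxW-++ x y)) (sym (⊔-assoc a (maxW x) (maxW y)))

maxW-shift : ∀ k y w → maxW (shift k (y ∷ w)) ≡ k + maxW (y ∷ w)
maxW-shift k y []      = trans (⊔-identityʳ (k + y)) (cong (k +_) (sym (⊔-identityʳ y)))
maxW-shift k y (z ∷ w) = trans (cong ((k + y) ⊔_) (maxW-shift k z w)) (sym (+-distribˡ-⊔ k y (maxW (z ∷ w))))

shift-shift : ∀ a b x → shift a (shift b x) ≡ shift (a + b) x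
shift-shift a b []      = refl
shift-shift a b (y ∷ x) = cong₂ _∷_ (sym (+-assoc a b y)) (shift-shift a b x)

shift-injective : ∀ k {x x′} → shift k x ≡ shift k x′ → x ≡ x′
shift-injective k = map-injective (+-cancelˡ-≡ k _ _)

Positive : Word → Set
Positive w = ∀ x → x ∈ w → 1 ≤ x

shift-> : ∀ m {u x} → Positive u → x ∈ shift m u → m < x
shift-> m pos-u x∈ with ∈-map⁻ (m +_) x∈
... | z , z∈ , refl = ≤-trans (≤-reflexive (+-comm 1 m)) (+-monoʳ-≤ m (pos-u z z∈))

maxW-⊙ : ∀ u v → maxW (u ⊙ v) ≡ maxW u + maxW v
maxW-⊙ []      v = refl
maxW-⊙ (y ∷ u) v = begin
  maxW (shift (maxW v) (y ∷ u) ++ v)           ≡⟨ maxW-++ (shift (maxW v) (y ∷ u)) v ⟩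
  maxW (shift (maxW v) (y ∷ u)) ⊔ maxW v       ≡⟨ cong (_⊔ maxW v) (maxW-shift (maxW v) y u) ⟩
  (maxW v + maxW (y ∷ u)) ⊔ maxW v             ≡⟨ m≥n⇒m⊔n≡m (m≤m+n (maxW v) _) ⟩
  maxW v + maxW (y ∷ u)                        ≡⟨ +-comm (maxW v) _ ⟩
  maxW (y ∷ u) + maxW v                        ∎
  where open ≡-Reasoning

length-⊙ : ∀ u v → length (u ⊙ v) ≡ length u + length v
length-⊙ u v = trans (length-++ (shift (maxW v) u)) (cong (_+ length v) (length-map _ u))

⊙-identityʳ : ∀ w → w ⊙ [] ≡ w
⊙-identityʳ w = trans (++-identityʳ (map (0 +_) w)) (map-id w)

⊙-assoc : ∀ x y z → (x ⊙ y) ⊙ z ≡ x ⊙ (y ⊙ z)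
⊙-assoc x y z = begin
  shift (maxW z) (shift (maxW y) x ++ y) ++ z                ≡⟨ cong (_++ z) (map-++ (maxW z +_) (shift (maxW y) x) y) ⟩
  (shift (maxW z) (shift (maxW y) x) ++ shift (maxW z) y) ++ z
    ≡⟨ ++-assoc (shift (maxW z) (shift (maxW y) x)) (shift (maxW z) y) z ⟩
  shift (maxW z) (shift (maxW y) x) ++ (y ⊙ z)              ≡⟨ cong (_++ (y ⊙ z)) (shift-shift (maxW z) (maxW y) x) ⟩
  shift (maxW z + maxW y) x ++ (y ⊙ z)
    ≡⟨ cong (λ m → shift m x ++ (y ⊙ z)) (trans (+-comm (maxW z) (maxW y)) (sym (maxW-⊙ y z))) ⟩
  x ⊙ (y ⊙ z)                                                ∎
  where open ≡-Reasoning

packed-[] : Packed []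
packed-[] = (λ _ ()) , λ { i (s≤s _) () }

packed-⊙ : ∀ u v → Packed u → Packed v → Packed (u ⊙ v)
packed-⊙ u v (pos-u , dense-u) (pos-v , dense-v) = positive , dense
  where
  positive : Positive (u ⊙ v)
  positive x x∈ with ∈-++⁻ (shift (maxW v) u) x∈
  ... | inj₁ x∈u′ = ≤-trans (s≤s z≤n) (shift-> (maxW v) pos-u x∈u′)
  ... | inj₂ x∈v  = pos-v x x∈v
  dense : ∀ i → 1 ≤ i → i ≤ maxW (u ⊙ v) → i ∈ u ⊙ v
  dense i 1≤i i≤ with i ≤? maxW v
  ... | yes i≤v = ∈-++⁺ʳ (shift (maxW v) u) (dense-v i 1≤i i≤v)
  ... | no  i≰v = ∈-++⁺ˡ (subst (_∈ shift (maxW v) u) (m+[n∸m]≡n (<⇒≤ v<i)) (∈-map⁺ (maxW v +_) i-v∈u))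
    where
    v<i = ≰⇒> i≰v
    i-v∈u : i ∸ maxW v ∈ u
    i-v∈u = dense-u (i ∸ maxW v) (m+n≤o⇒m≤o∸n 1 v<i)
              (≤-trans (∸-monoˡ-≤ (maxW v) (≤-trans i≤ (≤-reflexive (maxW-⊙ u v))))
                       (≤-reflexive (m+n∸n≡m (maxW u) (maxW v))))

-- φ_I and the red product

maxW-ins : ∀ a pos j J x → Admissible pos (j ∷ J) (length x) → (∀ {y} → y ∈ x → y ≤ a) →
           maxW (ins a pos (j ∷ J) x) ≡ a
maxW-ins a pos j J x adm ≤a = ≤-antisym
  (maxW≤ (ins a pos (j ∷ J) x) (λ y∈ → [ ≤a , ≤-reflexive ]′ (∈-ins⁻ a pos (j ∷ J) x y∈)))
  (∈⇒≤maxW _ (letter∈ins a pos j J x adm))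

maxW-φ : ∀ j J x → Admissible 1 (j ∷ J) (length x) → maxW (φ (j ∷ J) x) ≡ suc (maxW x)
maxW-φ j J x adm = maxW-ins _ 1 j J x adm (λ y∈ → ≤-trans (∈⇒≤maxW x y∈) (n≤1+n _))

suc-maxW∉ : ∀ x → ¬ suc (maxW x) ∈ x
suc-maxW∉ x m∈ = <-irrefl refl (∈⇒≤maxW x m∈)

packed-φ : ∀ j J x → Packed x → Admissible 1 (j ∷ J) (length x) → Packed (φ (j ∷ J) x)
packed-φ j J x (pos-x , dense-x) adm = positive , dense
  where
  positive : Positive (φ (j ∷ J) x)
  positive y y∈ with ∈-ins⁻ _ 1 (j ∷ J) x y∈
  ... | inj₁ y∈x  = pos-x y y∈x
  ... | inj₂ refl = s≤s z≤n
  dense : ∀ i → 1 ≤ i → i ≤ maxW (φ (j ∷ J) x) → i ∈ φ (j ∷ J) x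
  dense i 1≤i i≤ with i ≤? maxW x
  ... | yes i≤x = ∈-ins⁺ _ 1 (j ∷ J) x (dense-x i 1≤i i≤x)
  ... | no  i≰x = subst (_∈ φ (j ∷ J) x) (≤-antisym (≰⇒> i≰x) (≤-trans i≤ (≤-reflexive (maxW-φ j J x adm))))
                        (letter∈ins _ 1 j J x adm)

φ-injective : ∀ j J j′ J′ x x′ → Admissible 1 (j ∷ J) (length x) → Admissible 1 (j′ ∷ J′) (length x′) →
              φ (j ∷ J) x ≡ φ (j′ ∷ J′) x′ → j ∷ J ≡ j′ ∷ J′ × x ≡ x′
φ-injective j J j′ J′ x x′ adm adm′ eq =
  ins-injective (suc (maxW x)) 1 (j ∷ J) (j′ ∷ J′) x x′ adm adm′
    (suc-maxW∉ x) (subst (λ a → ¬ a ∈ x′) (sym same-letter) (suc-maxW∉ x′))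
    (trans eq (cong (λ a → ins a 1 (j′ ∷ J′) x′) (sym same-letter)))
  where
  same-letter : suc (maxW x) ≡ suc (maxW x′)
  same-letter = trans (sym (maxW-φ j J x adm)) (trans (cong maxW eq) (maxW-φ j′ J′ x′ adm′))

validI⇒admissible : ∀ {I n} → ValidI I n → Admissible 1 I n
validI⇒admissible ((_ , positive , incr) , bounded) = incr , positive , All.map s≤s bounded

validI⇒positive : ∀ {I n} → ValidI I n → All (1 ≤_) I
validI⇒positive ((_ , positive , _) , _) = positive

validI-shifted : ∀ k I n → ValidI I n → Admissible 1 (map (k +_) I) (k + n)
validI-shifted k I n ((_ , positive , incr) , bounded) =
  AllPairsP.map⁺ (AllPairs.map (+-monoʳ-< k) incr) ,
  AllP.map⁺ (All.map (λ {i} 1≤i → ≤-trans 1≤i (m≤n+m i k)) positive) ,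
  AllP.map⁺ (All.map (λ i≤ → s≤s (≤-trans (+-monoʳ-≤ k i≤) (≤-reflexive end-shifted))) bounded)
  where
  end-shifted : k + (n + length I) ≡ k + n + length (map (k +_) I)
  end-shifted = trans (sym (+-assoc k n (length I))) (cong (k + n +_) (sym (length-map _ I)))

admissible-redProd : ∀ u I v → ValidI I (length v) → Admissible 1 (map (length u +_) I) (length (u ⊙ v))
admissible-redProd u I v valid =
  subst (Admissible 1 (map (length u +_) I)) (sym (length-⊙ u v)) (validI-shifted (length u) I (length v) valid)

redProd-split : ∀ u I v → All (1 ≤_) I → redProd u I v ≡ shift (maxW v) u ++ ins (suc (maxW u + maxW v)) 1 I v
redProd-split u I v positive = begin
  ins (suc (maxW (u ⊙ v))) 1 (map (length u +_) I) (shift (maxW v) u ++ v)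
    ≡⟨ cong (λ a → ins a 1 (map (length u +_) I) (shift (maxW v) u ++ v)) (cong suc (maxW-⊙ u v)) ⟩
  ins A 1 (map (length u +_) I) (shift (maxW v) u ++ v)
    ≡⟨ ins-++-prefix A 1 (map (length u +_) I) (shift (maxW v) u) v (AllP.map⁺ (All.map beyond-u positive)) ⟩
  shift (maxW v) u ++ ins A (length (shift (maxW v) u) + 1) (map (length u +_) I) v
    ≡⟨ cong (λ p → shift (maxW v) u ++ ins A (p + 1) (map (length u +_) I) v) (length-map _ u) ⟩
  shift (maxW v) u ++ ins A (length u + 1) (map (length u +_) I) v
    ≡⟨ cong (shift (maxW v) u ++_) (ins-shift-positions A (length u) 1 I v) ⟩
  shift (maxW v) u ++ ins A 1 I v ∎
  where
  open ≡-Reasoning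
  A = suc (maxW u + maxW v)
  beyond-u : ∀ {i} → 1 ≤ i → length (shift (maxW v) u) + 1 ≤ length u + i
  beyond-u 1≤i = ≤-trans (≤-reflexive (cong (_+ 1) (length-map _ u))) (+-monoʳ-≤ (length u) 1≤i)

length-redProd : ∀ u I v → ValidI I (length v) → length (redProd u I v) ≡ length u + length v + length I
length-redProd u I v valid = begin
  length (redProd u I v)                                   ≡⟨ cong length (redProd-split u I v (validI⇒positive valid)) ⟩
  length (shift (maxW v) u ++ ins _ 1 I v)                 ≡⟨ length-++ (shift (maxW v) u) ⟩
  length (shift (maxW v) u) + length (ins _ 1 I v)
    ≡⟨ cong₂ _+_ (length-map _ u) (length-ins _ 1 I v (validI⇒admissible valid)) ⟩
  length u + (length v + length I)                         ≡⟨ sym (+-assoc (length u) _ _) ⟩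
  length u + length v + length I                           ∎
  where open ≡-Reasoning

maxW-redProd : ∀ u I v → ValidI I (length v) → maxW (redProd u I v) ≡ suc (maxW u + maxW v)
maxW-redProd u []      v ((I≢[] , _) , _) = contradiction refl I≢[]
maxW-redProd u (i ∷ I) v valid =
  trans (maxW-φ _ _ (u ⊙ v) (admissible-redProd u (i ∷ I) v valid)) (cong suc (maxW-⊙ u v))

packed-redProd : ∀ u I v → Packed u → Packed v → ValidI I (length v) → Packed (redProd u I v)
packed-redProd u []      v _      _      ((I≢[] , _) , _) = contradiction refl I≢[]
packed-redProd u (i ∷ I) v pack-u pack-v valid =
  packed-φ _ _ (u ⊙ v) (packed-⊙ u v pack-u pack-v) (admissible-redProd u (i ∷ I) v valid)

redProd-injective : ∀ u I v u₂ I₂ v₂ → ValidI I (length v) → ValidI I₂ (length v₂) →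
                    redProd u I v ≡ redProd u₂ I₂ v₂ →
                    map (length u +_) I ≡ map (length u₂ +_) I₂ × u ⊙ v ≡ u₂ ⊙ v₂
redProd-injective u []      v u₂ I₂        v₂ ((I≢[] , _) , _) _ _ = contradiction refl I≢[]
redProd-injective u (i ∷ I) v u₂ []        v₂ _ ((I≢[] , _) , _) _ = contradiction refl I≢[]
redProd-injective u (i ∷ I) v u₂ (i₂ ∷ I₂) v₂ valid valid₂ eq =
  φ-injective _ _ _ _ (u ⊙ v) (u₂ ⊙ v₂)
    (admissible-redProd u (i ∷ I) v valid) (admissible-redProd u₂ (i₂ ∷ I₂) v₂ valid₂) eq

-- Global descents and irreducible decompositions

Dominates : Word → Word → Set
Dominates xs ys = ∀ x y → x ∈ xs → y ∈ ys → y < x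

dominates? : ∀ xs ys → Dec (Dominates xs ys)
dominates? xs ys =
  map′ (λ all< x y x∈ y∈ → All.lookup (All.lookup all< x∈) y∈)
       (λ dom → All.tabulate (λ x∈ → All.tabulate (λ y∈ → dom _ _ x∈ y∈)))
       (All.all? (λ x → All.all? (_<? x) ys) xs)

shift-dominates : ∀ u v → Positive u → Dominates (shift (maxW v) u) v
shift-dominates u v pos-u x y x∈ y∈ = <-≤-trans (s≤s (∈⇒≤maxW v y∈)) (shift-> (maxW v) pos-u x∈)

globalDescent? : ∀ w c → Dec (GlobalDescent w c)
globalDescent? w c = (1 ≤? c) ×-dec (suc c ≤? length w) ×-dec dominates? (take c w) (drop c w)

hasGlobalDescent? : ∀ w → Dec (∃ (GlobalDescent w))
hasGlobalDescent? w =
  map′ (λ { (c , _ , descent) → c , descent }) (λ { (c , descent) → c , proj₁ (proj₂ descent) , descent })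
       (anyUpTo? (globalDescent? w) (length w))

globalDescent⇒maxW∉drop : ∀ w c → GlobalDescent w c → ¬ maxW w ∈ drop c w
globalDescent⇒maxW∉drop (x ∷ w) (suc c) (_ , _ , dom) max∈ =
  <-irrefl refl (<-≤-trans (dom x (maxW (x ∷ w)) (here refl) max∈) (∈⇒≤maxW (x ∷ w) (here refl)))

globalDescent-in-block : ∀ M v R k → 1 ≤ k → suc k ≤ length v →
                         Dominates (take k (shift M v ++ R)) (drop k (shift M v ++ R)) → GlobalDescent v k
globalDescent-in-block M v R k 1≤k k<v dom = 1≤k , k<v , λ x y x∈ y∈ →
  +-cancelˡ-< M y x (dom (M + x) (M + y) (in-take (∈-map⁺ (M +_) x∈)) (in-drop (∈-map⁺ (M +_) y∈)))
  where
  k≤ : k ≤ length (shift M v)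
  k≤ = ≤-trans (<⇒≤ k<v) (≤-reflexive (sym (length-map _ v)))
  in-take : shift M (take k v) ⊆ take k (shift M v ++ R)
  in-take = subst (_ ∈_) (sym (take-++-≤ k (shift M v) R k≤)) ∘ subst (_ ∈_) (sym (take-map k v))
  in-drop : shift M (drop k v) ⊆ drop k (shift M v ++ R)
  in-drop = subst (_ ∈_) (sym (drop-++-≤ k (shift M v) R k≤)) ∘ ∈-++⁺ˡ ∘ subst (_ ∈_) (sym (drop-map k v))

⊙-longerˡ : ∀ a b → b ≢ [] → length a < length (a ⊙ b)
⊙-longerˡ a b b≢[] = ≤-trans (≤-trans (≤-reflexive (+-comm 1 (length a))) (+-monoʳ-≤ (length a) (≢[]⇒1≤length b b≢[])))
                             (≤-reflexive (sym (length-⊙ a b)))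

⊙-longerʳ : ∀ a b → a ≢ [] → length b < length (a ⊙ b)
⊙-longerʳ a b a≢[] = ≤-trans (+-monoˡ-≤ (length b) (≢[]⇒1≤length a a≢[])) (≤-reflexive (sym (length-⊙ a b)))

⨀ : List Word → Word
⨀ = foldr _⊙_ []

PackedIrreducible : Word → Set
PackedIrreducible x = Packed x × Irreducible x

packed-⨀ : ∀ ws → All Packed ws → Packed (⨀ ws)
packed-⨀ []       []               = packed-[]
packed-⨀ (w ∷ ws) (pack-w ∷ packs) = packed-⊙ w (⨀ ws) pack-w (packed-⨀ ws packs)

⨀-++ : ∀ as bs → ⨀ (as ++ bs) ≡ ⨀ as ⊙ ⨀ bs
⨀-++ []       bs = refl
⨀-++ (a ∷ as) bs = trans (cong (a ⊙_) (⨀-++ as bs)) (sym (⊙-assoc a (⨀ as) (⨀ bs)))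

length-≤-⨀ : ∀ ws → All (λ x → length x ≤ length (⨀ ws)) ws
length-≤-⨀ []       = []
length-≤-⨀ (w ∷ ws) =
  ≤-trans (m≤m+n (length w) _) (≤-reflexive (sym (length-⊙ w (⨀ ws)))) ∷
  All.map (λ ≤ws → ≤-trans ≤ws (≤-trans (m≤n+m _ (length w)) (≤-reflexive (sym (length-⊙ w (⨀ ws))))))
          (length-≤-⨀ ws)

⨀-split-last : ∀ w ws → All Packed (w ∷ ws) →
               ∃ λ P → ⨀ (w ∷ ws) ≡ P ++ lastOr w ws × Dominates P (lastOr w ws)
⨀-split-last w []        _ = [] , ⊙-identityʳ w , λ _ _ ()
⨀-split-last w (w′ ∷ ws) (pack-w ∷ packs) with ⨀-split-last w′ ws packs
... | P , eq , dom = S ++ P , trans (cong (S ++_) eq) (sym (++-assoc S P _)) , dom′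
  where
  S = shift (maxW (⨀ (w′ ∷ ws))) w
  dom′ : Dominates (S ++ P) (lastOr w′ ws)
  dom′ x y x∈ y∈ with ∈-++⁻ S x∈
  ... | inj₁ x∈S = shift-dominates w (⨀ (w′ ∷ ws)) (proj₁ pack-w) x y x∈S (subst (_ ∈_) (sym eq) (∈-++⁺ʳ P y∈))
  ... | inj₂ x∈P = dom x y x∈P y∈

⊙-conicalˡ : ∀ a b → a ⊙ b ≡ [] → a ≡ []
⊙-conicalˡ [] b _ = refl

-- The first |a| letters of a ⊙ b dominate the rest; inside a longer irreducible a′ that is a global descent.
⊙-irreducible-prefix-length : ∀ a b a′ b′ → Positive a → a ≢ [] → Irreducible a′ →
                              a ⊙ b ≡ a′ ⊙ b′ → ¬ length a < length a′
⊙-irreducible-prefix-length a b a′ b′ pos-a a≢[] (_ , no-descent) eq a<a′ =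
  no-descent (length a , globalDescent-in-block (maxW b′) a′ b′ (length a) (≢[]⇒1≤length a a≢[]) a<a′ dom)
  where
  |a| = length a
  splits : take |a| (a ⊙ b) ≡ shift (maxW b) a × drop |a| (a ⊙ b) ≡ b
  splits = trans (cong (λ k → take k (a ⊙ b)) (sym (length-map _ a))) (take-length-++ (shift (maxW b) a) b) ,
           trans (cong (λ k → drop k (a ⊙ b)) (sym (length-map _ a))) (drop-length-++ (shift (maxW b) a) b)
  dom : Dominates (take |a| (a′ ⊙ b′)) (drop |a| (a′ ⊙ b′))
  dom = subst (λ w → Dominates (take |a| w) (drop |a| w)) eq
              (subst₂ Dominates (sym (proj₁ splits)) (sym (proj₂ splits)) (shift-dominates a b pos-a))

irreducible-⊙-injective : ∀ a b a′ b′ → PackedIrreducible a → PackedIrreducible a′ →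
                          a ⊙ b ≡ a′ ⊙ b′ → a ≡ a′ × b ≡ b′
irreducible-⊙-injective a b a′ b′ ((pos-a , _) , irr-a) ((pos-a′ , _) , irr-a′) eq
  with <-cmp (length a) (length a′)
... | tri< a<a′ _ _ = contradiction a<a′ (⊙-irreducible-prefix-length a b a′ b′ pos-a (proj₁ irr-a) irr-a′ eq)
... | tri> _ _ a′<a = contradiction a′<a (⊙-irreducible-prefix-length a′ b′ a b pos-a′ (proj₁ irr-a′) irr-a (sym eq))
... | tri≈ _ |a|≡|a′| _
  with ++-cancel-length (shift (maxW b) a) b (shift (maxW b′) a′) b′ eq
         (trans (length-map _ a) (trans |a|≡|a′| (sym (length-map _ a′))))
... | shifts-eq , refl = shift-injective (maxW b) shifts-eq , refl

⨀-injective : ∀ ws ws′ → All PackedIrreducible ws → All PackedIrreducible ws′ → ⨀ ws ≡ ⨀ ws′ → ws ≡ ws′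
⨀-injective []       []         _               _                 _  = refl
⨀-injective []       (w′ ∷ ws′) _               ((_ , w′≢[] , _) ∷ _) eq = contradiction (⊙-conicalˡ w′ _ (sym eq)) w′≢[]
⨀-injective (w ∷ ws) []         ((_ , w≢[] , _) ∷ _) _            eq = contradiction (⊙-conicalˡ w _ eq) w≢[]
⨀-injective (w ∷ ws) (w′ ∷ ws′) (irr ∷ irrs)    (irr′ ∷ irrs′)    eq
  with irreducible-⊙-injective w (⨀ ws) w′ (⨀ ws′) irr irr′ eq
... | refl , rest-eq = cong (w ∷_) (⨀-injective ws ws′ irrs irrs′ rest-eq)

dominates⇒>maxW : ∀ P b → Positive P → Dominates P b → ∀ x → x ∈ P → maxW b < x
dominates⇒>maxW P []      pos-P _   x x∈ = pos-P x x∈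
dominates⇒>maxW P (y ∷ b) _     dom x x∈ = dom x _ x∈ (maxW∈ y b)

map-+-∸ : ∀ m P → (∀ x → x ∈ P → m ≤ x) → map (m +_) (map (_∸ m) P) ≡ P
map-+-∸ m []      _   = refl
map-+-∸ m (x ∷ P) m≤ = cong₂ _∷_ (m+[n∸m]≡n (m≤ x (here refl))) (map-+-∸ m P (λ z → m≤ z ∘ there))

++-as-⊙ : ∀ P b → (∀ x → x ∈ P → maxW b < x) → P ++ b ≡ map (_∸ maxW b) P ⊙ b
++-as-⊙ P b above = cong (_++ b) (sym (map-+-∸ (maxW b) P (λ x → <⇒≤ ∘ above x)))

packed-dominated-suffix : ∀ P b → Packed (P ++ b) → (∀ x → x ∈ P → maxW b < x) → Packed b
packed-dominated-suffix P b (pos-w , dense-w) above = (λ x → pos-w x ∘ ∈-++⁺ʳ P) , dense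
  where
  dense : ∀ i → 1 ≤ i → i ≤ maxW b → i ∈ b
  dense i 1≤i i≤ with ∈-++⁻ P (dense-w i 1≤i (≤-trans i≤ (maxW≤ b (∈⇒≤maxW (P ++ b) ∘ ∈-++⁺ʳ P))))
  ... | inj₁ i∈P = contradiction (<-≤-trans (above i i∈P) i≤) (<-irrefl refl)
  ... | inj₂ i∈b = i∈b

packed-dominating-prefix : ∀ P b → Packed (P ++ b) → (∀ x → x ∈ P → maxW b < x) → Packed (map (_∸ maxW b) P)
packed-dominating-prefix P b (pos-w , dense-w) above = positive , dense
  where
  a = map (_∸ maxW b) P
  positive : Positive a
  positive x x∈ with ∈-map⁻ (_∸ maxW b) x∈
  ... | z , z∈ , refl = m+n≤o⇒m≤o∸n 1 (above z z∈)
  maxW-w : maxW (P ++ b) ≡ maxW a + maxW b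
  maxW-w = trans (cong maxW (++-as-⊙ P b above)) (maxW-⊙ a b)
  dense : ∀ i → 1 ≤ i → i ≤ maxW a → i ∈ a
  dense i 1≤i i≤ with ∈-++⁻ P (dense-w (maxW b + i) (≤-trans 1≤i (m≤n+m i (maxW b)))
                                 (≤-trans (≤-reflexive (+-comm (maxW b) i))
                                          (≤-trans (+-monoˡ-≤ (maxW b) i≤) (≤-reflexive (sym maxW-w)))))
  ... | inj₁ b+i∈P = subst (_∈ a) (m+n∸m≡n (maxW b) i) (∈-map⁺ (_∸ maxW b) b+i∈P)
  ... | inj₂ b+i∈b = contradiction (≤-trans (≤-trans (≤-reflexive (+-comm 1 (maxW b))) (+-monoʳ-≤ (maxW b) 1≤i))
                                            (∈⇒≤maxW b b+i∈b))
                                   (<-irrefl refl)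

globalDescent-split : ∀ w c → Packed w → GlobalDescent w c →
                      ∃ λ a → ∃ λ b → Packed a × Packed b × w ≡ a ⊙ b × length a < length w × length b < length w
globalDescent-split w c pack-w (1≤c , c<w , dom) =
  a , b , packed-dominating-prefix P b pack-P++b above , packed-dominated-suffix P b pack-P++b above ,
  trans (sym (take++drop≡id c w)) (++-as-⊙ P b above) , a<w , b<w
  where
  P = take c w
  b = drop c w
  a = map (_∸ maxW b) P
  pack-P++b : Packed (P ++ b)
  pack-P++b = subst Packed (sym (take++drop≡id c w)) pack-w
  above : ∀ x → x ∈ P → maxW b < x
  above = dominates⇒>maxW P b (λ x → proj₁ pack-w x ∘ ∈-take c w) dom
  |a|≡c : length a ≡ c
  |a|≡c = trans (length-map _ P) (length-take-≤ c w (<⇒≤ c<w))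
  |b|≡ : length b ≡ length w ∸ c
  |b|≡ = length-drop c w
  a<w : length a < length w
  a<w = subst (_< length w) (sym |a|≡c) c<w
  b<w : length b < length w
  b<w = subst (_< length w) (sym |b|≡) (∸-monoʳ-< {o = 0} 1≤c (<⇒≤ c<w))

irrDecomp : ∀ w → Packed w → ∃ (IrrDecomp w)
irrDecomp w = go w (<-wellFounded (length w))
  where
  go : ∀ w → Acc _<_ (length w) → Packed w → ∃ (IrrDecomp w)
  go []      _         _    = [] , refl , []
  go (x ∷ w) (acc rec) pack with hasGlobalDescent? (x ∷ w)
  ... | no  no-descent = (x ∷ w) ∷ [] , sym (⊙-identityʳ (x ∷ w)) , (pack , (λ ()) , no-descent) ∷ []
  ... | yes (c , descent) with globalDescent-split (x ∷ w) c pack descent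
  ...   | a , b , pack-a , pack-b , eq , a< , b< with go a (rec a<) pack-a | go b (rec b<) pack-b
  ...     | as , eq-a , irr-as | bs , eq-b , irr-bs =
    as ++ bs , trans eq (trans (cong₂ _⊙_ eq-a eq-b) (sym (⨀-++ as bs))) , AllP.++⁺ irr-as irr-bs

-- Red factorizations

RedProduct : Word → Word → List ℕ → Word → Set
RedProduct w u I v = Packed u × Packed v × ValidI I (length v) × w ≡ redProd u I v

-- Characterizes the maximality of |u| in a red factorization.
HeadWithinFirstFactor : List ℕ → Word → Set
HeadWithinFirstFactor []      v = ⊥
HeadWithinFirstFactor (i ∷ I) v =
  v ≡ [] ⊎ ∃ λ v₁ → ∃ λ rest → v ≡ v₁ ⊙ rest × PackedIrreducible v₁ × i ≤ length v₁

redProd-absorb : ∀ u v₁ rest J → All (1 ≤_) J →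
                 redProd u (map (length v₁ +_) J) (v₁ ⊙ rest) ≡ redProd (u ⊙ v₁) J rest
redProd-absorb u v₁ rest J positive = begin
  redProd u (map (c +_) J) (v₁ ⊙ rest)
    ≡⟨ redProd-split u (map (c +_) J) (v₁ ⊙ rest) (AllP.map⁺ (All.map (λ {j} 1≤j → ≤-trans 1≤j (m≤n+m j c)) positive)) ⟩
  S ++ ins A 1 (map (c +_) J) (V₁ ++ rest)
    ≡⟨ cong (S ++_) (ins-++-prefix A 1 (map (c +_) J) V₁ rest (AllP.map⁺ (All.map beyond-V₁ positive))) ⟩
  S ++ V₁ ++ ins A (length V₁ + 1) (map (c +_) J) rest
    ≡⟨ cong (λ p → S ++ V₁ ++ ins A (p + 1) (map (c +_) J) rest) (length-map _ v₁) ⟩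
  S ++ V₁ ++ ins A (c + 1) (map (c +_) J) rest
    ≡⟨ cong (λ z → S ++ V₁ ++ z) (ins-shift-positions A c 1 J rest) ⟩
  S ++ V₁ ++ ins A 1 J rest
    ≡⟨ sym (++-assoc S V₁ _) ⟩
  (S ++ V₁) ++ ins A 1 J rest
    ≡⟨ cong₂ (λ m a → (shift m u ++ V₁) ++ ins a 1 J rest)
             (trans (maxW-⊙ v₁ rest) (+-comm (maxW v₁) (maxW rest)))
             (cong suc (trans (cong (maxW u +_) (maxW-⊙ v₁ rest)) (sym (+-assoc (maxW u) (maxW v₁) (maxW rest))))) ⟩
  (shift (maxW rest + maxW v₁) u ++ V₁) ++ ins (suc (maxW u + maxW v₁ + maxW rest)) 1 J rest
    ≡⟨ cong₂ (λ z a → z ++ ins a 1 J rest)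
             (trans (cong (_++ V₁) (sym (shift-shift (maxW rest) (maxW v₁) u))) (sym (map-++ (maxW rest +_) (shift (maxW v₁) u) v₁)))
             (cong (λ m → suc (m + maxW rest)) (sym (maxW-⊙ u v₁))) ⟩
  shift (maxW rest) (u ⊙ v₁) ++ ins (suc (maxW (u ⊙ v₁) + maxW rest)) 1 J rest
    ≡⟨ sym (redProd-split (u ⊙ v₁) J rest positive) ⟩
  redProd (u ⊙ v₁) J rest ∎
  where
  open ≡-Reasoning
  c  = length v₁
  S  = shift (maxW (v₁ ⊙ rest)) u
  V₁ = shift (maxW rest) v₁
  A  = suc (maxW u + maxW (v₁ ⊙ rest))
  beyond-V₁ : ∀ {j} → 1 ≤ j → length V₁ + 1 ≤ c + j
  beyond-V₁ 1≤j = ≤-trans (≤-reflexive (cong (_+ 1) (length-map _ v₁))) (+-monoʳ-≤ c 1≤j)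

validI-unshifted : ∀ c J n → All (1 ≤_) J → ValidI (map (c +_) J) (c + n) → ValidI J n
validI-unshifted c []      n _        ((J≢[] , _) , _)          = contradiction refl J≢[]
validI-unshifted c (j ∷ J) n positive ((_ , _ , incr) , bounded) =
  ((λ ()) , positive , AllPairs.map (+-cancelˡ-< c _ _) (AllPairsP.map⁻ incr)) ,
  All.map (λ c+j≤ → +-cancelˡ-≤ c _ _ (≤-trans c+j≤ (≤-reflexive end))) (AllP.map⁻ bounded)
  where
  end : c + n + length (map (c +_) (j ∷ J)) ≡ c + (n + length (j ∷ J))
  end = trans (cong (c + n +_) (length-map _ (j ∷ J))) (+-assoc c n _)

redProduct-absorb : ∀ w u v₁ rest J → RedProduct w u (map (length v₁ +_) J) (v₁ ⊙ rest) →
                    Packed v₁ → Packed rest → All (1 ≤_) J → RedProduct w (u ⊙ v₁) J rest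
redProduct-absorb w u v₁ rest J (pack-u , _ , valid , eq) pack-v₁ pack-rest positive =
  packed-⊙ u v₁ pack-u pack-v₁ , pack-rest ,
  validI-unshifted (length v₁) J (length rest) positive (subst (ValidI _) (length-⊙ v₁ rest) valid) ,
  trans eq (redProd-absorb u v₁ rest J positive)

⊙-overlap : ∀ u v u₂ v₂ → u ⊙ v ≡ u₂ ⊙ v₂ → Positive u₂ → length u ≤ length u₂ →
            ∃ λ D → v ≡ D ++ v₂ × length D ≡ length u₂ ∸ length u × Dominates D v₂
⊙-overlap u v u₂ v₂ eq pos-u₂ u≤u₂ = D , v≡ , |D|≡ , λ x y x∈ → shift-dominates u₂ v₂ pos-u₂ x y (∈-drop (length u) S₂ x∈)
  where
  S  = shift (maxW v) u
  S₂ = shift (maxW v₂) u₂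
  D  = drop (length u) S₂
  v≡ : v ≡ D ++ v₂
  v≡ = begin
    v                           ≡⟨ sym (drop-length-++ S v) ⟩
    drop (length S) (S ++ v)    ≡⟨ cong (λ k → drop k (S ++ v)) (length-map _ u) ⟩
    drop (length u) (u ⊙ v)     ≡⟨ cong (drop (length u)) eq ⟩
    drop (length u) (u₂ ⊙ v₂)   ≡⟨ drop-++-≤ (length u) S₂ v₂ (≤-trans u≤u₂ (≤-reflexive (sym (length-map _ u₂)))) ⟩
    D ++ v₂                     ∎
    where open ≡-Reasoning
  |D|≡ : length D ≡ length u₂ ∸ length u
  |D|≡ = trans (length-drop (length u) S₂) (cong (_∸ length u) (length-map _ u₂))

headWithin⇒¬dominatedPrefix : ∀ i I v D v₂ → HeadWithinFirstFactor (i ∷ I) v → v ≡ D ++ v₂ →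
                              Dominates D v₂ → 1 ≤ length D → ¬ length D < i
headWithin⇒¬dominatedPrefix i I v D v₂ (inj₁ v≡[]) v≡ _ 1≤D _ with D
... | [] = contradiction 1≤D λ ()
... | _ ∷ _ = contradiction (trans (sym v≡) v≡[]) λ ()
headWithin⇒¬dominatedPrefix i I v D v₂ (inj₂ (v₁ , rest , v≡v₁⊙ , (_ , _ , no-descent) , i≤v₁)) v≡ dom 1≤D D<i =
  no-descent (length D , globalDescent-in-block (maxW rest) v₁ rest (length D) 1≤D (≤-trans D<i i≤v₁) dom′)
  where
  dom′ : Dominates (take (length D) (v₁ ⊙ rest)) (drop (length D) (v₁ ⊙ rest))
  dom′ = subst (λ z → Dominates (take (length D) z) (drop (length D) z)) (trans (sym v≡) v≡v₁⊙)
               (subst₂ Dominates (sym (take-length-++ D v₂)) (sym (drop-length-++ D v₂)) dom)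

-- A longer left factor u₂ would make the overlap D (the part of u₂ lying over v)
-- dominate the rest, i.e. a global descent of the first factor of v before position i.
redProduct-maximal : ∀ w u I v → RedProduct w u I v → HeadWithinFirstFactor I v →
                     ∀ u₂ I₂ v₂ → Packed u₂ → Packed v₂ → ValidI I₂ (length v₂) →
                     w ≡ redProd u₂ I₂ v₂ → length u₂ ≤ length u
redProduct-maximal w u (i ∷ I) v _ _ u₂ [] v₂ _ _ ((I₂≢[] , _) , _) _ = contradiction refl I₂≢[]
redProduct-maximal w u (i ∷ I) v (_ , _ , valid , eq) within u₂ (i₂ ∷ I₂) v₂ (pos-u₂ , _) _ valid₂ eq₂
  with length u₂ ≤? length u
... | yes u₂≤u = u₂≤u
... | no  u₂≰u = contradiction D<i (headWithin⇒¬dominatedPrefix i I v D v₂ within v≡ dom 1≤D)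
  where
  u<u₂ = ≰⇒> u₂≰u
  same = redProd-injective u (i ∷ I) v u₂ (i₂ ∷ I₂) v₂ valid valid₂ (trans (sym eq) eq₂)
  overlapping = ⊙-overlap u v u₂ v₂ (proj₂ same) pos-u₂ (<⇒≤ u<u₂)
  D = proj₁ overlapping
  v≡ = proj₁ (proj₂ overlapping)
  |D|≡ = proj₁ (proj₂ (proj₂ overlapping))
  dom = proj₂ (proj₂ (proj₂ overlapping))
  u+D≡u₂ : length u + length D ≡ length u₂
  u+D≡u₂ = trans (cong (length u +_) |D|≡) (m+[n∸m]≡n (<⇒≤ u<u₂))
  1≤D : 1 ≤ length D
  1≤D = subst (1 ≤_) (sym |D|≡) (m<n⇒0<n∸m u<u₂)
  D<i : length D < i
  D<i = +-cancelˡ-≤ (length u) _ _ (begin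
    length u + suc (length D)   ≡⟨ trans (+-suc (length u) (length D)) (cong suc u+D≡u₂) ⟩
    suc (length u₂)             ≡⟨ +-comm 1 (length u₂) ⟩
    length u₂ + 1               ≤⟨ +-monoʳ-≤ (length u₂) (All.head (validI⇒positive valid₂)) ⟩
    length u₂ + i₂              ≡⟨ sym (∷-injectiveˡ (proj₁ same)) ⟩
    length u + i                ∎)
    where open ≤-Reasoning

redFact-unique : ∀ w u I v u₂ I₂ v₂ → RedFact w u I v → RedFact w u₂ I₂ v₂ → u ≡ u₂ × I ≡ I₂ × v ≡ v₂
redFact-unique w u I v u₂ I₂ v₂ (pack-u , pack-v , valid , eq , max) (pack-u₂ , pack-v₂ , valid₂ , eq₂ , max₂) =
  u≡u₂ , I≡I₂ , v≡v₂
  where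
  |u|≡|u₂| : length u ≡ length u₂
  |u|≡|u₂| = ≤-antisym (max₂ u I v pack-u pack-v valid eq) (max u₂ I₂ v₂ pack-u₂ pack-v₂ valid₂ eq₂)
  same = redProd-injective u I v u₂ I₂ v₂ valid valid₂ (trans (sym eq) eq₂)
  I≡I₂ : I ≡ I₂
  I≡I₂ = map-injective (+-cancelˡ-≡ (length u) _ _)
           (trans (proj₁ same) (cong (λ k → map (k +_) I₂) (sym |u|≡|u₂|)))
  split = ++-cancel-length (shift (maxW v) u) v (shift (maxW v₂) u₂) v₂ (proj₂ same)
            (trans (length-map _ u) (trans |u|≡|u₂| (sym (length-map _ u₂))))
  v≡v₂ : v ≡ v₂
  v≡v₂ = proj₂ split
  u≡u₂ : u ≡ u₂
  u≡u₂ = shift-injective (maxW v) (trans (proj₁ split) (cong (λ z → shift (maxW z) u₂) (sym v≡v₂)))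

toRedFact : ∀ {w u I v} → RedProduct w u I v → HeadWithinFirstFactor I v → RedFact w u I v
toRedFact {w} {u} {I} {v} prod@(pack-u , pack-v , valid , eq) within =
  pack-u , pack-v , valid , eq , redProduct-maximal w u I v prod within

absorb-first-factor : ∀ w u i I v₁ rest → RedProduct w u (i ∷ I) (v₁ ⊙ rest) → Packed v₁ → Packed rest →
                      length v₁ < i → RedProduct w (u ⊙ v₁) (map (_∸ length v₁) (i ∷ I)) rest
absorb-first-factor w u i I v₁ rest prod@(_ , _ , ((_ , _ , incr) , _) , _) pack-v₁ pack-rest v₁<i =
  redProduct-absorb w u v₁ rest J (subst (λ K → RedProduct w u K (v₁ ⊙ rest)) (sym lift) prod)
                    pack-v₁ pack-rest (AllP.map⁺ (All.map (m+n≤o⇒m≤o∸n 1) beyond-v₁))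
  where
  c = length v₁
  J = map (_∸ c) (i ∷ I)
  beyond-v₁ : All (c <_) (i ∷ I)
  beyond-v₁ = v₁<i ∷ All.map (<-trans v₁<i) (AllPairs.head incr)
  lift : map (c +_) J ≡ i ∷ I
  lift = map-+-∸ c (i ∷ I) (λ x → <⇒≤ ∘ All.lookup beyond-v₁)

redFact-exists : ∀ w u I v → RedProduct w u I v → ∃ λ u′ → ∃ λ I′ → ∃ λ v′ → RedFact w u′ I′ v′
redFact-exists w u I v = go u I v (<-wellFounded (length v))
  where
  go : ∀ u I v → Acc _<_ (length v) → RedProduct w u I v → ∃ λ u′ → ∃ λ I′ → ∃ λ v′ → RedFact w u′ I′ v′
  go u []      v       _         (_ , _ , ((I≢[] , _) , _) , _) = contradiction refl I≢[]
  go u (i ∷ I) []      _         prod = u , i ∷ I , [] , toRedFact prod (inj₁ refl)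
  go u (i ∷ I) (y ∷ v) (acc rec) prod with irrDecomp (y ∷ v) (proj₁ (proj₂ prod))
  ... | [] , () , _
  ... | v₁ ∷ vs , v≡ , irr₁@(pack-v₁ , v₁≢[] , _) ∷ irrs with i ≤? length v₁
  ...   | yes i≤v₁ = u , i ∷ I , y ∷ v , toRedFact prod (inj₂ (v₁ , ⨀ vs , v≡ , irr₁ , i≤v₁))
  ...   | no  i≰v₁ =
    go (u ⊙ v₁) _ (⨀ vs) (rec (subst (λ z → length (⨀ vs) < length z) (sym v≡) (⊙-longerʳ v₁ (⨀ vs) v₁≢[])))
       (absorb-first-factor w u i I v₁ (⨀ vs) (subst (RedProduct w u (i ∷ I)) v≡ prod)
                            pack-v₁ (packed-⨀ vs (All.map proj₁ irrs)) (≰⇒> i≰v₁))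

redFact⇒head≤firstFactor : ∀ w u i I v₁ rest → RedFact w u (i ∷ I) (v₁ ⊙ rest) →
                           PackedIrreducible v₁ → Packed rest → i ≤ length v₁
redFact⇒head≤firstFactor w u i I v₁ rest (pack-u , pack-v , valid , eq , max) (pack-v₁ , v₁≢[] , _) pack-rest
  with i ≤? length v₁
... | yes i≤v₁ = i≤v₁
... | no  i≰v₁ = contradiction (max (u ⊙ v₁) _ rest pack-u′ pack-rest valid′ eq′) (<⇒≱ (⊙-longerˡ u v₁ v₁≢[]))
  where
  absorbed = absorb-first-factor w u i I v₁ rest (pack-u , pack-v , valid , eq) pack-v₁ pack-rest (≰⇒> i≰v₁)
  pack-u′ = proj₁ absorbed
  valid′ = proj₁ (proj₂ (proj₂ absorbed))
  eq′ = proj₂ (proj₂ (proj₂ absorbed))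

-- F_R and T_R are functional, weight-preserving and red-packed

mutual
  FR⇒FS≡ : ∀ {w f} → FR w f → FS f ≡ w
  FR⇒FS≡ (mkFR (w≡ , _) trs) = trans (TRs⇒FS≡⨀ trs) (sym w≡)

  TRs⇒FS≡⨀ : ∀ {ws ts} → TRs ws ts → FS ts ≡ ⨀ ws
  TRs⇒FS≡⨀ []         = refl
  TRs⇒FS≡⨀ (tr ∷ trs) = cong₂ _⊙_ (TR⇒TS≡ tr) (TRs⇒FS≡⨀ trs)

  TR⇒TS≡ : ∀ {w t} → TR w t → TS t ≡ w
  TR⇒TS≡ (mkTR {I = I} (_ , _ , _ , w≡ , _) fu fv) =
    trans (cong₂ (λ a b → redProd a I b) (FR⇒FS≡ fu) (FR⇒FS≡ fv)) (sym w≡)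

mutual
  FR-functional : ∀ {w f f′} → FR w f → FR w f′ → f ≡ f′
  FR-functional (mkFR (w≡ , irrs) trs) (mkFR (w≡′ , irrs′) trs′)
    with ⨀-injective _ _ irrs irrs′ (trans (sym w≡) w≡′)
  ... | refl = TRs-functional trs trs′

  TRs-functional : ∀ {ws ts ts′} → TRs ws ts → TRs ws ts′ → ts ≡ ts′
  TRs-functional []         []           = refl
  TRs-functional (tr ∷ trs) (tr′ ∷ trs′) = cong₂ _∷_ (TR-functional tr tr′) (TRs-functional trs trs′)

  TR-functional : ∀ {w t t′} → TR w t → TR w t′ → t ≡ t′
  TR-functional (mkTR {I = I} rf fu fv) (mkTR rf′ fu′ fv′) with redFact-unique _ _ _ _ _ _ _ rf rf′
  ... | refl , refl , refl = cong₂ (Node I) (FR-functional fu fu′) (FR-functional fv fv′)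

mutual
  FR⇒ωF≡length : ∀ {w f} → FR w f → ωF f ≡ length w
  FR⇒ωF≡length (mkFR (w≡ , _) trs) = trans (TRs⇒ωF≡length trs) (cong length (sym w≡))

  TRs⇒ωF≡length : ∀ {ws ts} → TRs ws ts → ωF ts ≡ length (⨀ ws)
  TRs⇒ωF≡length []                        = refl
  TRs⇒ωF≡length (_∷_ {w} {ws} tr trs) =
    trans (cong₂ _+_ (TR⇒ω≡length tr) (TRs⇒ωF≡length trs)) (sym (length-⊙ w (⨀ ws)))

  TR⇒ω≡length : ∀ {w t} → TR w t → ω t ≡ length w
  TR⇒ω≡length (mkTR {w} {u} {I} {v} {fl} {fr} (_ , _ , valid , w≡ , _) fu fv) = begin
    length I + ωF fl + ωF fr       ≡⟨ cong₂ (λ a b → length I + a + b) (FR⇒ωF≡length fu) (FR⇒ωF≡length fv) ⟩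
    length I + length u + length v ≡⟨ trans (+-assoc (length I) _ _) (+-comm (length I) _) ⟩
    length u + length v + length I ≡⟨ sym (trans (cong length w≡) (length-redProd u I v valid)) ⟩
    length w                       ∎
    where open ≡-Reasoning

TRs⇒ω-lastOr : ∀ {w ws t ts} → TRs (w ∷ ws) (t ∷ ts) → ω (lastOr t ts) ≡ length (lastOr w ws)
TRs⇒ω-lastOr (tr ∷ [])          = TR⇒ω≡length tr
TRs⇒ω-lastOr (_ ∷ (tr′ ∷ trs))  = TRs⇒ω-lastOr (tr′ ∷ trs)

-- If every inserted position lies before the last irreducible factor L of v,
-- everything in front of L is above max(L).
redProd-descent-at-last-factor : ∀ u i I P L → Positive u → L ≢ [] → ValidI (i ∷ I) (length (P ++ L)) →
                                 Dominates P L → lastOr i I ≤ length (i ∷ I) + length P →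
                                 ∃ (GlobalDescent (redProd u (i ∷ I) (P ++ L)))
redProd-descent-at-last-factor u i I P L pos-u L≢[] valid@((_ , positive , incr) , _) dom last≤ =
  length Pre , 1≤Pre , Pre<w , subst₂ Dominates (sym take≡) (sym drop≡) dom-Pre
  where
  v = P ++ L
  A = suc (maxW u + maxW v)
  S = shift (maxW v) u
  Pre = S ++ ins A 1 (i ∷ I) P
  adm-P : Admissible 1 (i ∷ I) (length P)
  adm-P = incr , positive ,
          All.map (λ j≤ → s≤s (≤-trans j≤ (≤-trans last≤ (≤-reflexive (+-comm _ (length P))))))
                  (increasing-≤lastOr i I incr)
  w≡ : redProd u (i ∷ I) v ≡ Pre ++ L
  w≡ = trans (redProd-split u (i ∷ I) v positive)
             (trans (cong (S ++_) (ins-++-suffix A 1 (i ∷ I) P L adm-P)) (sym (++-assoc S _ L)))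
  take≡ : take (length Pre) (redProd u (i ∷ I) v) ≡ Pre
  take≡ = trans (cong (take (length Pre)) w≡) (take-length-++ Pre L)
  drop≡ : drop (length Pre) (redProd u (i ∷ I) v) ≡ L
  drop≡ = trans (cong (drop (length Pre)) w≡) (drop-length-++ Pre L)
  |Pre|≡ : length Pre ≡ length u + (length P + length (i ∷ I))
  |Pre|≡ = trans (length-++ S) (cong₂ _+_ (length-map _ u) (length-ins A 1 (i ∷ I) P adm-P))
  1≤Pre : 1 ≤ length Pre
  1≤Pre = ≤-trans (s≤s z≤n) (≤-trans (m≤n+m _ (length P)) (≤-trans (m≤n+m _ (length u)) (≤-reflexive (sym |Pre|≡))))
  Pre<w : suc (length Pre) ≤ length (redProd u (i ∷ I) v)
  Pre<w = ≤-trans (≤-trans (≤-reflexive (+-comm 1 (length Pre))) (+-monoʳ-≤ (length Pre) (≢[]⇒1≤length L L≢[])))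
                  (≤-reflexive (sym (trans (cong length w≡) (length-++ Pre))))
  y≤maxW : ∀ {y} → y ∈ L → y ≤ maxW v
  y≤maxW = ∈⇒≤maxW v ∘ ∈-++⁺ʳ P
  dom-Pre : Dominates Pre L
  dom-Pre x y x∈ y∈ with ∈-++⁻ S x∈
  ... | inj₁ x∈S = <-≤-trans (s≤s (y≤maxW y∈)) (shift-> (maxW v) pos-u x∈S)
  ... | inj₂ x∈Y with ∈-ins⁻ A 1 (i ∷ I) P x∈Y
  ...   | inj₁ x∈P  = dom x y x∈P y∈
  ...   | inj₂ refl = s≤s (≤-trans (y≤maxW y∈) (m≤n+m _ (maxW u)))

irreducible-redProd⇒last-beyond : ∀ u i I P L → Positive u → L ≢ [] → ValidI (i ∷ I) (length (P ++ L)) →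
                                  Dominates P L → Irreducible (redProd u (i ∷ I) (P ++ L)) →
                                  length (i ∷ I) + length P < lastOr i I
irreducible-redProd⇒last-beyond u i I P L pos-u L≢[] valid dom (_ , no-descent) =
  ≰⇒> (no-descent ∘ redProd-descent-at-last-factor u i I P L pos-u L≢[] valid dom)

TR⇒redCond : ∀ {w u I v fr} → RedFact w u I v → FR v fr → Irreducible w → RedCond I fr
TR⇒redCond {I = I} {fr = []} (_ , _ , valid , _) fv _ with FR⇒FS≡ fv
... | refl = admissible-[]⇒consecutive 1 I (validI⇒admissible valid)
TR⇒redCond {I = []} {fr = r ∷ rs} (_ , _ , ((I≢[] , _) , _) , _) _ _ = contradiction refl I≢[]
TR⇒redCond {w} {u} {i ∷ I} {v} {r ∷ rs} rf@(pack-u , _ , valid@((_ , positive , _) , bounded) , w≡ , _)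
           fv@(mkFR (v≡ , irrs@(irr₁ ∷ irrs′)) (_∷_ {v₁} {vs} tr₁ trs)) irr =
  (All.head positive , i≤r) , m+n≤o⇒m≤o∸n 1 (s≤s last≤) , m≤n+o⇒m∸n≤o _ (lastOr i I) end≤
  where
  p = length (i ∷ I)
  W = ωF (r ∷ rs)
  W≡ : W ≡ length v
  W≡ = FR⇒ωF≡length fv
  i≤r : i ≤ ω r
  i≤r = subst (i ≤_) (sym (TR⇒ω≡length tr₁))
              (redFact⇒head≤firstFactor w u i I v₁ (⨀ vs) (subst (RedFact w u (i ∷ I)) v≡ rf) irr₁
                                        (packed-⨀ vs (All.map proj₁ irrs′)))
  last≤ : lastOr i I ≤ p + W
  last≤ = ≤-trans (All.lookup bounded (lastOr∈ i I)) (≤-reflexive (trans (+-comm (length v) p) (cong (p +_) (sym W≡))))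
  L = lastOr v₁ vs
  split = ⨀-split-last v₁ vs (All.map proj₁ irrs)
  P = proj₁ split
  v≡P++L : v ≡ P ++ L
  v≡P++L = trans v≡ (proj₁ (proj₂ split))
  beyond : p + length P < lastOr i I
  beyond = irreducible-redProd⇒last-beyond u i I P L (proj₁ pack-u) (proj₁ (proj₂ (All-lastOr irrs)))
             (subst (λ z → ValidI (i ∷ I) (length z)) v≡P++L valid) (proj₂ (proj₂ split))
             (subst Irreducible (trans w≡ (cong (redProd u (i ∷ I)) v≡P++L)) irr)
  end≤ : suc (p + W) ≤ lastOr i I + ω (lastOr r rs)
  end≤ = begin
    suc (p + W)                      ≡⟨ cong (λ n → suc (p + n)) (trans W≡ (trans (cong length v≡P++L) (length-++ P))) ⟩
    suc (p + (length P + length L))  ≡⟨ cong suc (sym (+-assoc p _ _)) ⟩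
    suc (p + length P) + length L    ≤⟨ +-monoˡ-≤ (length L) beyond ⟩
    lastOr i I + length L            ≡⟨ cong (lastOr i I +_) (sym (TRs⇒ω-lastOr (tr₁ ∷ trs))) ⟩
    lastOr i I + ω (lastOr r rs)     ∎
    where open ≤-Reasoning

mutual
  FR⇒redPacked : ∀ {w f} → FR w f → RedPackedF f
  FR⇒redPacked (mkFR (_ , irrs) trs) = TRs⇒redPacked trs irrs

  TRs⇒redPacked : ∀ {ws ts} → TRs ws ts → All PackedIrreducible ws → RedPackedF ts
  TRs⇒redPacked []         []                  = tt
  TRs⇒redPacked (tr ∷ trs) ((_ , irr) ∷ irrs) = TR⇒redPacked tr irr , TRs⇒redPacked trs irrs

  TR⇒redPacked : ∀ {w t} → TR w t → Irreducible w → RedPackedT t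
  TR⇒redPacked (mkTR rf@(_ , _ , (isSet , _) , _) fu fv) irr =
    isSet , FR⇒redPacked fu , FR⇒redPacked fv , TR⇒redCond rf fv irr

-- F_R and T_R are total

positionsOf : ℕ → ℕ → Word → List ℕ
positionsOf a pos []      = []
positionsOf a pos (y ∷ w) with y ≟ a
... | yes _ = pos ∷ positionsOf a (suc pos) w
... | no  _ = positionsOf a (suc pos) w

without : ℕ → Word → Word
without a []      = []
without a (y ∷ w) with y ≟ a
... | yes _ = without a w
... | no  _ = y ∷ without a w

positionsOf-≥ : ∀ a pos w → All (pos ≤_) (positionsOf a pos w)
positionsOf-≥ a pos []      = []
positionsOf-≥ a pos (y ∷ w) with y ≟ a
... | yes _ = ≤-refl ∷ All.map (≤-trans (n≤1+n pos)) (positionsOf-≥ a (suc pos) w)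
... | no  _ = All.map (≤-trans (n≤1+n pos)) (positionsOf-≥ a (suc pos) w)

positionsOf-< : ∀ a pos w → All (_< pos + length w) (positionsOf a pos w)
positionsOf-< a pos []      = []
positionsOf-< a pos (y ∷ w) with y ≟ a
... | yes _ = m<m+n pos (s≤s z≤n) ∷ All.map (λ j< → ≤-trans j< (≤-reflexive (sym (+-suc pos _)))) (positionsOf-< a (suc pos) w)
... | no  _ = All.map (λ j< → ≤-trans j< (≤-reflexive (sym (+-suc pos _)))) (positionsOf-< a (suc pos) w)

positionsOf-increasing : ∀ a pos w → AllPairs _<_ (positionsOf a pos w)
positionsOf-increasing a pos []      = []
positionsOf-increasing a pos (y ∷ w) with y ≟ a
... | yes _ = positionsOf-≥ a (suc pos) w ∷ positionsOf-increasing a (suc pos) w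
... | no  _ = positionsOf-increasing a (suc pos) w

positionsOf-nonempty : ∀ a pos w → a ∈ w → positionsOf a pos w ≢ []
positionsOf-nonempty a pos (y ∷ w) a∈ with y ≟ a
positionsOf-nonempty a pos (y ∷ w) a∈         | yes _   = λ ()
positionsOf-nonempty a pos (y ∷ w) (here a≡y) | no  y≢a = contradiction (sym a≡y) y≢a
positionsOf-nonempty a pos (y ∷ w) (there a∈) | no  _   = positionsOf-nonempty a (suc pos) w a∈

length-without+positionsOf : ∀ a pos w → length (without a w) + length (positionsOf a pos w) ≡ length w
length-without+positionsOf a pos []      = refl
length-without+positionsOf a pos (y ∷ w) with y ≟ a
... | yes _ = trans (+-suc _ _) (cong suc (length-without+positionsOf a (suc pos) w))
... | no  _ = cong suc (length-without+positionsOf a (suc pos) w)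

ins-positionsOf-without : ∀ a pos w → ins a pos (positionsOf a pos w) (without a w) ≡ w
ins-positionsOf-without a pos []      = refl
ins-positionsOf-without a pos (y ∷ w) with y ≟ a
... | yes refl = trans (ins-here y pos _ (without y w)) (cong (y ∷_) (ins-positionsOf-without y (suc pos) w))
... | no  _    = trans (ins-++-prefix a pos _ (y ∷ []) (without a w) (positionsOf-≥ a (suc pos) w))
                       (cong (y ∷_) (ins-positionsOf-without a (suc pos) w))

∈-without⁻ : ∀ a w {y} → y ∈ without a w → y ∈ w × y ≢ a
∈-without⁻ a (z ∷ w) y∈ with z ≟ a
∈-without⁻ a (z ∷ w) y∈         | yes _   = map₁ there (∈-without⁻ a w y∈)
∈-without⁻ a (z ∷ w) (here refl) | no  z≢a = here refl , z≢a
∈-without⁻ a (z ∷ w) (there y∈)  | no  _   = map₁ there (∈-without⁻ a w y∈)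

∈-without⁺ : ∀ a w {y} → y ∈ w → y ≢ a → y ∈ without a w
∈-without⁺ a (z ∷ w) y∈ y≢a with z ≟ a
∈-without⁺ a (z ∷ w) (here refl) y≢a | yes z≡a = contradiction z≡a y≢a
∈-without⁺ a (z ∷ w) (there y∈)  y≢a | yes _   = ∈-without⁺ a w y∈ y≢a
∈-without⁺ a (z ∷ w) (here refl) y≢a | no  _   = here refl
∈-without⁺ a (z ∷ w) (there y∈)  y≢a | no  _   = there (∈-without⁺ a w y∈ y≢a)

maxW< : ∀ x A → 1 ≤ A → (∀ {z} → z ∈ x → z < A) → maxW x < A
maxW< []      A 1≤A _  = 1≤A
maxW< (z ∷ x) A _   <A = <A (maxW∈ z x)

≤suc-maxW : ∀ A x → (∀ i → 1 ≤ i → i < A → i ∈ x) → A ≤ suc (maxW x)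
≤suc-maxW zero          x _      = z≤n
≤suc-maxW (suc zero)    x _      = s≤s z≤n
≤suc-maxW (suc (suc k)) x below∈ = s≤s (∈⇒≤maxW x (below∈ (suc k) (s≤s z≤n) ≤-refl))

-- Deleting the largest letter A of w exhibits w as ε ◁_R φ_J(x), J being the positions of A.
maxLetter-redProduct : ∀ w → Packed w → w ≢ [] → ∃ λ J → ∃ λ x → RedProduct w [] J x
maxLetter-redProduct []         _                  w≢[] = contradiction refl w≢[]
maxLetter-redProduct w@(y ∷ w′) (pos-w , dense-w) _    = J , x , packed-[] , (pos-x , dense-x) , valid , w≡
  where
  A = maxW w
  J = positionsOf A 1 w
  x = without A w
  A∈w : A ∈ w
  A∈w = maxW∈ y w′
  pos-x : Positive x
  pos-x z = pos-w z ∘ proj₁ ∘ ∈-without⁻ A w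
  x<A : ∀ {z} → z ∈ x → z < A
  x<A z∈ = ≤∧≢⇒< (∈⇒≤maxW w (proj₁ (∈-without⁻ A w z∈))) (proj₂ (∈-without⁻ A w z∈))
  below-A∈x : ∀ i → 1 ≤ i → i < A → i ∈ x
  below-A∈x i 1≤i i<A = ∈-without⁺ A w (dense-w i 1≤i (<⇒≤ i<A)) (λ i≡A → <-irrefl i≡A i<A)
  maxW-x<A : maxW x < A
  maxW-x<A = maxW< x A (pos-w A A∈w) x<A
  suc-maxW-x≡A : suc (maxW x) ≡ A
  suc-maxW-x≡A = ≤-antisym maxW-x<A (≤suc-maxW A x below-A∈x)
  dense-x : ∀ i → 1 ≤ i → i ≤ maxW x → i ∈ x
  dense-x i 1≤i i≤ = below-A∈x i 1≤i (≤-<-trans i≤ maxW-x<A)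
  valid : ValidI J (length x)
  valid = (positionsOf-nonempty A 1 w A∈w , positionsOf-≥ A 1 w , positionsOf-increasing A 1 w) ,
          All.map (λ j< → ≤-trans (≤-pred j<) (≤-reflexive (sym (length-without+positionsOf A 1 w))))
                  (positionsOf-< A 1 w)
  w≡ : w ≡ redProd [] J x
  w≡ = sym (trans (cong (λ K → ins (suc (maxW x)) 1 K x) (map-id J))
                  (trans (cong (λ a → ins a 1 J x) suc-maxW-x≡A) (ins-positionsOf-without A 1 w)))

redFact-shorter : ∀ {w u I v} → RedFact w u I v → length u < length w × length v < length w
redFact-shorter {w} {u} {I} {v} (_ , _ , valid , w≡ , _) =
  ≤-trans (s≤s (m≤m+n (length u) (length v))) u+v<w , ≤-trans (s≤s (m≤n+m (length v) (length u))) u+v<w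
  where
  u+v<w : length u + length v < length w
  u+v<w = ≤-trans (≤-trans (≤-reflexive (+-comm 1 _)) (+-monoʳ-≤ _ (≢[]⇒1≤length I (proj₁ (proj₁ valid)))))
                  (≤-reflexive (sym (trans (cong length w≡) (length-redProd u I v valid))))

mutual
  FR-total : ∀ w → Acc _<_ (length w) → Packed w → ∃ (FR w)
  FR-total w acc-w pack with irrDecomp w pack
  ... | ws , w≡ , irrs with TRs-total ws (length w) acc-w
                              (subst (λ z → All (λ x → length x ≤ length z) ws) (sym w≡) (length-≤-⨀ ws)) irrs
  ...   | ts , trs = ts , mkFR (w≡ , irrs) trs

  TRs-total : ∀ ws n → Acc _<_ n → All (λ x → length x ≤ n) ws → All PackedIrreducible ws → ∃ (TRs ws)
  TRs-total []       n _     []         []                       = [] , []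
  TRs-total (w ∷ ws) n acc-n (w≤n ∷ ≤n) ((pack , w≢[] , _) ∷ irrs)
    with TR-total w n acc-n w≤n pack w≢[] | TRs-total ws n acc-n ≤n irrs
  ... | t , tr | ts , trs = t ∷ ts , tr ∷ trs

  TR-total : ∀ w n → Acc _<_ n → length w ≤ n → Packed w → w ≢ [] → ∃ (TR w)
  TR-total w n (acc rec) w≤n pack w≢[] with maxLetter-redProduct w pack w≢[]
  ... | J , x , prod with redFact-exists w [] J x prod
  ...   | u , I , v , rf@(pack-u , pack-v , _) with redFact-shorter rf
  ...     | u<w , v<w with FR-total u (rec (<-≤-trans u<w w≤n)) pack-u | FR-total v (rec (<-≤-trans v<w w≤n)) pack-v
  ...       | fl , fu | fr , fv = Node I fl fr , mkTR rf fu fv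

-- Irreducibility of red products

globalDescent-after-maxW : ∀ w Q R c → w ≡ Q ++ maxW w ∷ R → GlobalDescent w c →
                           ∃ λ e → take c w ≡ Q ++ maxW w ∷ take e R × drop c w ≡ drop e R
globalDescent-after-maxW w Q R c w≡ descent with c ≤? length Q
... | yes c≤Q = contradiction (subst (maxW w ∈_) (sym drop≡) (∈-++⁺ʳ (drop c Q) (here refl)))
                              (globalDescent⇒maxW∉drop w c descent)
  where
  drop≡ : drop c w ≡ drop c Q ++ maxW w ∷ R
  drop≡ = trans (cong (drop c) w≡) (drop-++-≤ c Q _ c≤Q)
... | no  c≰Q = e , trans (cong₂ take c≡ w≡) (take-++-+ (suc e) Q _) , trans (cong₂ drop c≡ w≡) (drop-++-+ (suc e) Q _)
  where
  e = c ∸ suc (length Q)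
  c≡ : c ≡ length Q + suc e
  c≡ = trans (sym (m+[n∸m]≡n (≰⇒> c≰Q))) (sym (+-suc (length Q) e))

globalDescent-transfer : ∀ w L c c′ → GlobalDescent w c → 1 ≤ c′ →
                         take c′ L ⊆ take c w → drop c′ L ≡ drop c w → GlobalDescent L c′
globalDescent-transfer w L c c′ (_ , c<w , dom) 1≤c′ take⊆ drop≡ =
  1≤c′ , c′<L , λ x y x∈ y∈ → dom x y (take⊆ x∈) (subst (y ∈_) drop≡ y∈)
  where
  c′<L : suc c′ ≤ length L
  c′<L with drop-nonempty c w c<w
  ... | y , y∈ = ∈-drop⇒< c′ L (subst (y ∈_) (sym drop≡) y∈)

maxW-last⇒noDescent : ∀ w Q → w ≡ Q ++ maxW w ∷ [] → ¬ ∃ (GlobalDescent w)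
maxW-last⇒noDescent w Q w≡ (c , descent@(_ , c<w , _)) with globalDescent-after-maxW w Q [] c w≡ descent
... | e , _ , drop≡ with drop-nonempty c w c<w
...   | y , y∈ = contradiction (subst (y ∈_) (trans drop≡ (drop-[] e)) y∈) λ ()

-- A descent of w would have to start after the maximum, hence inside L, where
-- everything of L before it already lies in Q: it would be a descent of L.
maxW-before-suffix⇒noDescent : ∀ w Q L k′ → w ≡ Q ++ maxW w ∷ drop k′ L → take k′ L ⊆ Q → 1 ≤ k′ →
                               ¬ ∃ (GlobalDescent L) → ¬ ∃ (GlobalDescent w)
maxW-before-suffix⇒noDescent w Q L k′ w≡ take⊆Q 1≤k′ no-descent-L (c , descent)
  with globalDescent-after-maxW w Q (drop k′ L) c w≡ descent
... | e , take≡ , drop≡ =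
  no-descent-L (k′ + e , globalDescent-transfer w L c (k′ + e) descent (≤-trans 1≤k′ (m≤m+n k′ e)) take⊆
                                                (trans (sym (drop-drop k′ e L)) (sym drop≡)))
  where
  take⊆ : take (k′ + e) L ⊆ take c w
  take⊆ x∈ with ∈-++⁻ (take k′ L) (subst (_ ∈_) (take-+ k′ e L) x∈)
  ... | inj₁ x∈k′ = subst (_ ∈_) (sym take≡) (∈-++⁺ˡ (take⊆Q x∈k′))
  ... | inj₂ x∈e  = subst (_ ∈_) (sym take≡) (∈-++⁺ʳ Q (there x∈e))

HitsLastFactor : List ℕ → Word → Set
HitsLastFactor I v =
  v ≡ [] ⊎ ∃ λ P → ∃ λ L → v ≡ P ++ L × PackedIrreducible L × Any (1 + length I + length P ≤_) I

redProd-irreducible : ∀ u I v → ValidI I (length v) → HitsLastFactor I v → Irreducible (redProd u I v)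
redProd-irreducible u []      v ((I≢[] , _) , _) _ = contradiction refl I≢[]
redProd-irreducible u (i ∷ I) v valid hits = w≢[] , no-descent hits
  where
  w = redProd u (i ∷ I) v
  A = suc (maxW u + maxW v)
  S = shift (maxW v) u
  adm = validI⇒admissible valid
  maxW-w : maxW w ≡ A
  maxW-w = maxW-redProd u (i ∷ I) v valid
  w≢[] : w ≢ []
  w≢[] w≡[] = contradiction (trans (sym maxW-w) (cong maxW w≡[])) λ ()
  around : ∀ Z k → ins A 1 (i ∷ I) v ≡ Z ++ A ∷ drop k v → w ≡ (S ++ Z) ++ maxW w ∷ drop k v
  around Z k Y≡ = trans (redProd-split u (i ∷ I) v (validI⇒positive valid))
                        (trans (cong (S ++_) Y≡) (trans (sym (++-assoc S Z _))
                                                        (cong (λ a → (S ++ Z) ++ a ∷ drop k v) (sym maxW-w))))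
  no-descent : HitsLastFactor (i ∷ I) v → ¬ ∃ (GlobalDescent w)
  no-descent (inj₁ v≡[]) with ins-split-last A 1 i I v adm
  ... | Z , k , Y≡ , _ =
    maxW-last⇒noDescent w (S ++ Z)
      (trans (around Z k Y≡) (cong (λ R → (S ++ Z) ++ maxW w ∷ R) (trans (cong (drop k) v≡[]) (drop-[] k))))
  no-descent (inj₂ (P , L , v≡ , (_ , _ , no-descent-L) , far))
    with ins-split-last-beyond A 1 (i ∷ I) v (length P) adm far
  ... | Z , k , P<k , Y≡ , take⊆Z =
    maxW-before-suffix⇒noDescent w (S ++ Z) L k′ (trans (around Z k Y≡) (cong (λ R → (S ++ Z) ++ maxW w ∷ R) drop≡))
                                 (∈-++⁺ʳ S ∘ take⊆Z ∘ subst (_ ∈_) (sym take≡) ∘ ∈-++⁺ʳ P) (m<n⇒0<n∸m P<k) no-descent-L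
    where
    k′ = k ∸ length P
    k≡ : k ≡ length P + k′
    k≡ = sym (m+[n∸m]≡n (<⇒≤ P<k))
    drop≡ : drop k v ≡ drop k′ L
    drop≡ = trans (cong₂ drop k≡ v≡) (drop-++-+ k′ P L)
    take≡ : take k v ≡ P ++ take k′ L
    take≡ = trans (cong₂ take k≡ v≡) (take-++-+ k′ P L)

-- F_R^* and T_R^* invert F_R and T_R

TS-Sound : Tree → Set
TS-Sound t = PackedIrreducible (TS t) × length (TS t) ≡ ω t × TR (TS t) t

FS≡⨀ : ∀ f → FS f ≡ ⨀ (map TS f)
FS≡⨀ []      = refl
FS≡⨀ (t ∷ f) = cong (TS t ⊙_) (FS≡⨀ f)

sound⇒irreducibles : ∀ f → All TS-Sound f → All PackedIrreducible (map TS f)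
sound⇒irreducibles f = AllP.map⁺ ∘ All.map proj₁

sound⇒packed : ∀ f → All TS-Sound f → Packed (FS f)
sound⇒packed f sound = subst Packed (sym (FS≡⨀ f)) (packed-⨀ (map TS f) (All.map proj₁ (sound⇒irreducibles f sound)))

sound⇒length : ∀ f → All TS-Sound f → length (FS f) ≡ ωF f
sound⇒length []      []                      = refl
sound⇒length (t ∷ f) ((_ , |t|≡ , _) ∷ sound) = trans (length-⊙ (TS t) (FS f)) (cong₂ _+_ |t|≡ (sound⇒length f sound))

sound⇒FR : ∀ f → All TS-Sound f → FR (FS f) f
sound⇒FR f sound = mkFR (FS≡⨀ f , sound⇒irreducibles f sound) (TRs-of f sound)
  where
  TRs-of : ∀ f → All TS-Sound f → TRs (map TS f) f
  TRs-of []      []                   = []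
  TRs-of (t ∷ f) ((_ , _ , tr) ∷ sound) = tr ∷ TRs-of f sound

redCond⇒validI : ∀ I fr → IsSet I → RedCond I fr → length (FS fr) ≡ ωF fr → ValidI I (length (FS fr))
redCond⇒validI I        []       isSet I≡ _ =
  isSet , subst (All (_≤ length I)) (sym I≡) (AllP.applyUpTo⁺₁ suc (length I) (λ i<I → i<I))
redCond⇒validI []       (r ∷ rs) _     () _
redCond⇒validI (i ∷ I) (r ∷ rs) isSet@(_ , _ , incr) (_ , 1≤end-last , _) |v|≡ =
  isSet , All.map (λ j≤ → ≤-trans j≤ last≤) (increasing-≤lastOr i I incr)
  where
  last≤ : lastOr i I ≤ length (FS (r ∷ rs)) + length (i ∷ I)
  last≤ = ≤-trans (≤-pred (≤-trans (≤-reflexive (cong suc (sym (+-identityʳ _)))) (m<o∸n⇒n+m<o 0 _ _ 1≤end-last)))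
                  (≤-reflexive (trans (cong (length (i ∷ I) +_) (sym |v|≡)) (+-comm (length (i ∷ I)) _)))

redCond⇒headWithin : ∀ I fr → IsSet I → RedCond I fr → All TS-Sound fr → HeadWithinFirstFactor I (FS fr)
redCond⇒headWithin []      _        (I≢[] , _) _ _ = contradiction refl I≢[]
redCond⇒headWithin (i ∷ I) []       _ _ _ = inj₁ refl
redCond⇒headWithin (i ∷ I) (r ∷ rs) _ ((_ , i≤r) , _) ((irr-r , |r|≡ , _) ∷ _) =
  inj₂ (TS r , FS rs , refl , irr-r , subst (i ≤_) (sym |r|≡) i≤r)

redCond⇒hitsLast : ∀ I fr → RedCond I fr → All TS-Sound fr → HitsLastFactor I (FS fr)
redCond⇒hitsLast I       []       _ _ = inj₁ refl
redCond⇒hitsLast []      (r ∷ rs) () _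
redCond⇒hitsLast (i ∷ I) (r ∷ rs) (_ , _ , end-last≤) sound =
  inj₂ (P , L , v≡ , All-lastOr irrs , lose (lastOr∈ i I) (+-cancelʳ-≤ (length L) _ _ end≤))
  where
  irrs = sound⇒irreducibles (r ∷ rs) sound
  split = ⨀-split-last (TS r) (map TS rs) (All.map proj₁ irrs)
  P = proj₁ split
  L = lastOr (TS r) (map TS rs)
  v≡ : FS (r ∷ rs) ≡ P ++ L
  v≡ = trans (FS≡⨀ (r ∷ rs)) (proj₁ (proj₂ split))
  |L|≡ : length L ≡ ω (lastOr r rs)
  |L|≡ = trans (cong length (lastOr-map TS r rs)) (proj₁ (proj₂ (All-lastOr sound)))
  W≡ : ωF (r ∷ rs) ≡ length P + length L
  W≡ = trans (sym (sound⇒length (r ∷ rs) sound)) (trans (cong length v≡) (length-++ P))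
  end≤ : 1 + length (i ∷ I) + length P + length L ≤ lastOr i I + length L
  end≤ = ≤-trans (≤-reflexive (cong suc (trans (+-assoc (length (i ∷ I)) _ _) (cong (length (i ∷ I) +_) (sym W≡)))))
                 (m∸n≤o⇒m≤n+o _ _ (lastOr i I) (subst (suc (length (i ∷ I) + ωF (r ∷ rs)) ∸ lastOr i I ≤_) (sym |L|≡) end-last≤))

mutual
  TS-sound : ∀ t → RedPackedT t → TS-Sound t
  TS-sound (Node I fl fr) (isSet , rp-fl , rp-fr , cond) =
    (packed-redProd u I v pack-u pack-v valid , redProd-irreducible u I v valid (redCond⇒hitsLast I fr cond sound-r)) ,
    |w|≡ , mkTR (toRedFact (pack-u , pack-v , valid , refl) (redCond⇒headWithin I fr isSet cond sound-r))
                (sound⇒FR fl sound-l) (sound⇒FR fr sound-r)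
    where
    u = FS fl
    v = FS fr
    sound-l = FS-sound fl rp-fl
    sound-r = FS-sound fr rp-fr
    pack-u = sound⇒packed fl sound-l
    pack-v = sound⇒packed fr sound-r
    valid = redCond⇒validI I fr isSet cond (sound⇒length fr sound-r)
    |w|≡ : length (redProd u I v) ≡ ω (Node I fl fr)
    |w|≡ = trans (length-redProd u I v valid)
                 (trans (cong₂ (λ a b → a + b + length I) (sound⇒length fl sound-l) (sound⇒length fr sound-r))
                        (trans (+-comm _ (length I)) (sym (+-assoc (length I) _ _))))

  FS-sound : ∀ f → RedPackedF f → All TS-Sound f
  FS-sound []      _            = []
  FS-sound (t ∷ f) (rp-t , rp-f) = TS-sound t rp-t ∷ FS-sound f rp-f

mainTheorem5 : (n : ℕ) →
    IsBijWithInverse (λ w → Packed w × length w ≡ n)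
                     (λ f → RedPackedF f × ωF f ≡ n) FR FS
    × IsBijWithInverse (λ w → Packed w × Irreducible w × length w ≡ n)
                       (λ t → RedPackedT t × ω t ≡ n) TR TS
mainTheorem5 n = forests , trees
  where
  forests : IsBijWithInverse (λ w → Packed w × length w ≡ n) (λ f → RedPackedF f × ωF f ≡ n) FR FS
  forests = (λ w (pack , _) → FR-total w (<-wellFounded (length w)) pack)
          , (λ _ _ _ _ → FR-functional)
          , (λ _ _ (_ , |w|≡n) fr → FR⇒redPacked fr , trans (FR⇒ωF≡length fr) |w|≡n)
          , (λ _ _ _ → FR⇒FS≡)
          , (λ f (rp , ωf≡n) → let sound = FS-sound f rp in
               (sound⇒packed f sound , trans (sound⇒length f sound) ωf≡n) , sound⇒FR f sound)
  trees : IsBijWithInverse (λ w → Packed w × Irreducible w × length w ≡ n) (λ t → RedPackedT t × ω t ≡ n) TR TS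
  trees = (λ w (pack , (w≢[] , _) , _) → TR-total w (length w) (<-wellFounded (length w)) ≤-refl pack w≢[])
        , (λ _ _ _ _ → TR-functional)
        , (λ _ _ (_ , irr , |w|≡n) tr → TR⇒redPacked tr irr , trans (TR⇒ω≡length tr) |w|≡n)
        , (λ _ _ _ → TR⇒TS≡)
        , (λ t (rp , ωt≡n) → let (pack , irr) , |t|≡ , tr = TS-sound t rp in (pack , irr , trans |t|≡ ωt≡n) , tr)
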